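{- Let $q$ be an odd prime power and let $\mathcal{L}_0,\mathcal{L}_1$ be as in the context. Let $\ell\in\mathcal{L}_0$ (resp. $\ell\in\mathcal{L}_1$). Then the number of lines of $\mathcal{L}_0$ (resp. $\mathcal{L}_1$) meeting $\ell$ in exactly one point equals $q^2+(q-1)/2$, and the number of lines of $\mathcal{L}_1$ (resp. $\mathcal{L}_0$) meeting $\ell$ in exactly one point equals $(q+1)/2$.
   Context: Let $q$ be a power of an odd prime and $\mathrm{PG}(3,q)$ the projective space with homogeneous coordinates $(X_1,X_2,X_3,X_4)$. Fix a non-square $\omega\in\mathrm{GF}(q)$. Let $\mathcal{E}$ be the elliptic quadric $X_1^2-\omega X_2^2+X_3X_4=0$, with quadratic form $Q(X)=X_1^2-\omega X_2^2+X_3X_4$. Let $O_s$ (resp. $O_n$) be the set of points $X$ with $Q(X)$ a non-zero square (resp. a non-square) in $\mathrm{GF}(q)$. A line is tangent to $\mathcal{E}$ if it meets $\mathcal{E}$ in exactly one point. On a tangent line, the $q$ points other than the point of tangency all lie in $O_s$ or all lie in $O_n$; let $\mathcal{L}_0$ (resp. $\mathcal{L}_1$) be the set of tangent lines whose $q$ points off $\mathcal{E}$ lie in $O_s$ (resp. in $O_n$). -}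

module Defs where

open import Level using (0ℓ)
open import Algebra.Bundles using (CommutativeRing)
open import Data.Nat using (ℕ)
open import Data.Fin using (Fin) renaming (zero to 0F; suc to sucF)
open import Data.List using (List; length)
open import Data.List.Relation.Unary.All using (All)
open import Data.List.Relation.Unary.Any using (Any)
open import Data.List.Relation.Unary.AllPairs using (AllPairs)
open import Data.Product using (Σ; ∃; ∃₂; _×_; _,_)
open import Relation.Nullary using (¬_; Dec)
open import Relation.Binary.PropositionalEquality using (_≡_)

-- Finiteness is given by an explicit
-- enumeration of the carrier without repetitions (up to ≈); its length
-- is the order q.  (Every finite field has prime-power order, and
-- conversely GF(q) exists for every prime power q, so "q an odd prime
-- power" is exactly "q is the order of a finite field with 1 + 1 ≉ 0".)

record FiniteField : Set₁ where
  field
    commRing  : CommutativeRing 0ℓ 0ℓ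
  open CommutativeRing commRing public
  field
    1≉0       : ¬ (1# ≈ 0#)
    inverse   : ∀ x → ¬ (x ≈ 0#) → ∃ λ y → (x * y) ≈ 1#
    _≟_       : ∀ x y → Dec (x ≈ y)
    elements  : List Carrier
    complete  : ∀ x → Any (x ≈_) elements
    distinct  : AllPairs (λ x y → ¬ (x ≈ y)) elements
    odd       : ¬ ((1# + 1#) ≈ 0#)

  order : ℕ
  order = length elements

module PG3 (F : FiniteField) where
  open FiniteField F

  -- vectors of GF(q)^4 (coordinates X1..X4 are indices 0..3)
  V4 : Set
  V4 = Fin 4 → Carrier

  _≈ᵥ_ : V4 → V4 → Set
  u ≈ᵥ v = ∀ i → u i ≈ v i

  0ᵥ : V4
  0ᵥ _ = 0#

  lin : Carrier → V4 → Carrier → V4 → V4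
  lin a u b v i = (a * u i) + (b * v i)

  scale : Carrier → V4 → V4
  scale c u i = c * u i

  -- a vector representing a projective point
  NonZero : V4 → Set
  NonZero x = ¬ (x ≈ᵥ 0ᵥ)

  SamePoint : V4 → V4 → Set
  SamePoint x y = ∃ λ c → x ≈ᵥ scale c y

  IsSquare : Carrier → Set
  IsSquare a = ∃ λ b → (b * b) ≈ a

  record Line : Set where
    constructor mkLine
    field
      u v   : V4
      indep : ∀ a b → lin a u b v ≈ᵥ 0ᵥ → (a ≈ 0#) × (b ≈ 0#)

  OnLine : V4 → Line → Set
  OnLine x L = ∃₂ λ a b → x ≈ᵥ lin a (Line.u L) b (Line.v L)

  _≈L_ : Line → Line → Set
  L ≈L M = (OnLine (Line.u M) L × OnLine (Line.v M) L)
         × (OnLine (Line.u L) M × OnLine (Line.v L) M)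

  MeetInOnePoint : Line → Line → Set
  MeetInOnePoint L M =
    ∃ λ p → NonZero p × OnLine p L × OnLine p M ×
      (∀ r → NonZero r → OnLine r L → OnLine r M → SamePoint r p)

  HasSize : (Line → Set) → ℕ → Set
  HasSize P n =
    Σ (List Line) λ xs →
      (length xs ≡ n) × All P xs × AllPairs (λ L M → ¬ (L ≈L M)) xs ×
      (∀ L → P L → Any (L ≈L_) xs)

  module Quadric (ω : Carrier) where

    Q : V4 → Carrier
    Q x = ((x 0F * x 0F) + (- (ω * (x 1F * x 1F)))) + (x 2F * x 3F)
      where
      1F 2F 3F : Fin 4
      1F = sucF 0F
      2F = sucF (sucF 0F)
      3F = sucF (sucF (sucF 0F))

    OnE : V4 → Set
    OnE x = Q x ≈ 0#

    Tangent : Line → Set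
    Tangent L =
      ∃ λ p → NonZero p × OnLine p L × OnE p ×
        (∀ r → NonZero r → OnLine r L → OnE r → SamePoint r p)

    InL0 : Line → Set
    InL0 L = Tangent L ×
      (∀ r → NonZero r → OnLine r L → ¬ OnE r → IsSquare (Q r))

    InL1 : Line → Set
    InL1 L = Tangent L ×
      (∀ r → NonZero r → OnLine r L → ¬ OnE r → ¬ IsSquare (Q r))

module Submission where

-- The isometries swapping X₃ and X₄ and the Eichler transformations move the point of tangency of
-- ℓ to Z = (0, 0, 0, 1); a tangent line through Z lies in the tangent plane X₃ = 0 of E at Z, so
-- ℓ = ⟨Z, (α, β, 0, 0)⟩. A tangent line m meeting ℓ in exactly one point either passes through Z,
-- and is then ⟨Z, (a, b, 0, 0)⟩ with (a : b) ≠ (α : β) and class given by the square class of the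
-- norm a² − ω b², or it joins one of the q² points (x, y, 1, ·) of E off X₃ = 0 to its conjugate point
-- on ℓ, and then lies in the class of ℓ. Multiplication by an element of norm ω in GF(q²) shows that
-- exactly (q + 1)/2 of the q + 1 points (a : b) of PG(1, q) have square norm. Hence the class of ℓ
-- contains q² + (q + 1)/2 − 1 of these lines and the other class (q + 1)/2.

open import Defs
open import Level using (0ℓ)
open import Algebra.Bundles using (CommutativeRing)
import Algebra.Solver.Ring.AlmostCommutativeRing as ACR
import Algebra.Solver.Ring as RingSolver
open import Data.Integer as ℤ using (ℤ; +_; -[1+_]; _⊖_; _◃_)
import Data.Integer.Properties as ℤP
import Data.Sign as Sign
open import Data.Maybe using (Maybe; just; nothing)
import Relation.Binary.Reasoning.Setoid as SetoidReasoning
open import Data.Nat as ℕ using (ℕ; zero; suc; z≤n; s≤s)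
import Data.Nat.Properties as ℕP
import Data.Nat.DivMod as DivMod
open import Data.Fin as Fin using (Fin) renaming (zero to 0F; suc to sucF)
import Data.Fin.Properties as FinP
open import Data.List using (List; []; _∷_; length; map; filter; lookup; cartesianProduct; _++_)
import Data.List.Properties as ListP
open import Data.List.Relation.Unary.All as All using (All; []; _∷_)
import Data.List.Relation.Unary.All.Properties as AllP
open import Data.List.Relation.Unary.Any as Any using (Any; here; there)
open import Data.List.Relation.Unary.AllPairs using ([]; _∷_)
import Data.List.Relation.Unary.Any.Properties as AnyP
import Data.List.Relation.Unary.Unique.Setoid as UniqueS
import Data.List.Relation.Unary.Unique.Setoid.Properties as UniqueP
import Data.List.Membership.Setoid as MembershipS
import Data.List.Membership.Setoid.Properties as MembershipP
import Data.List.Membership.Propositional.Properties as ∈ₚP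
open import Data.Product using (Σ; ∃; ∃₂; _×_; _,_; proj₁; proj₂)
open import Data.Bool using (Bool; true; false)
open import Data.Product.Relation.Binary.Pointwise.NonDependent using (×-setoid)
open import Data.Sum using (_⊎_; inj₁; inj₂)
open import Data.Empty using (⊥; ⊥-elim)
open import Data.Unit using (⊤; tt)
open import Relation.Nullary using (¬_; Dec; yes; no; does)
open import Relation.Unary using (_∩_; _∪_; ∁; _⊆_) renaming (Decidable to Decidable₁)
open import Relation.Unary.Properties using (∁?)
open import Relation.Binary.Bundles using (Setoid)
open import Relation.Binary.PropositionalEquality as ≡ using (_≡_)

length-cartesianProduct : ∀ {A B : Set} (xs : List A) (ys : List B) →
  length (cartesianProduct xs ys) ≡ length xs ℕ.* length ys
length-cartesianProduct [] ys = ≡.refl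
length-cartesianProduct (x ∷ xs) ys = ≡.trans (ListP.length-++ (map (x ,_) ys))
  (≡.cong₂ ℕ._+_ (ListP.length-map (x ,_) ys) (length-cartesianProduct xs ys))

module Counting (S : Setoid 0ℓ 0ℓ) where
  open Setoid S renaming (Carrier to A)
  open UniqueS S using (Unique)
  open MembershipS S using (_∈_)
  private
    ∈-resp-≈ = MembershipP.∈-resp-≈ S
    ∈-lookup = MembershipP.∈-lookup S
    All[≉]⇒∉ = MembershipP.All[≉]⇒∉ S

  HasCard : (A → Set) → ℕ → Set
  HasCard P n = Σ (List A) λ xs → (length xs ≡ n) × All P xs × Unique xs × (∀ x → P x → x ∈ xs)

  Respects : (A → Set) → Set
  Respects P = ∀ {x y} → x ≈ y → P x → P y

  lookup-injective : ∀ {xs} → Unique xs → ∀ i j → lookup xs i ≈ lookup xs j → i ≡ j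
  lookup-injective (_ ∷ _) 0F 0F _ = ≡.refl
  lookup-injective {_ ∷ xs} (x∉xs ∷ _) 0F (sucF j) e = ⊥-elim (All[≉]⇒∉ x∉xs (∈-resp-≈ (sym e) (∈-lookup xs j)))
  lookup-injective {_ ∷ xs} (x∉xs ∷ _) (sucF i) 0F e = ⊥-elim (All[≉]⇒∉ x∉xs (∈-resp-≈ e (∈-lookup xs i)))
  lookup-injective (_ ∷ xs!) (sucF i) (sucF j) e = ≡.cong sucF (lookup-injective xs! i j e)

  hasCard-cong : ∀ {P P′ n} → P ⊆ P′ → P′ ⊆ P → HasCard P n → HasCard P′ n
  hasCard-cong P⊆P′ P′⊆P (xs , len , all , xs! , complete) =
    xs , len , All.map P⊆P′ all , xs! , λ x p′ → complete x (P′⊆P p′)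

  hasCard-singleton : ∀ {R : A → Set} y → R y → HasCard (R ∩ (_≈ y)) 1
  hasCard-singleton y r = y ∷ [] , ≡.refl , (r , refl) ∷ [] , [] ∷ [] , λ _ p → here (proj₂ p)

  module _ {D : A → Set} (D? : Decidable₁ D) (D-resp : Respects D) where

    private
      length-filter-∁ : ∀ xs → length (filter D? xs) ℕ.+ length (filter (∁? D?) xs) ≡ length xs
      length-filter-∁ [] = ≡.refl
      length-filter-∁ (x ∷ xs) with D? x
      ... | yes _ = ≡.cong suc (length-filter-∁ xs)
      ... | no _ = ≡.trans (ℕP.+-suc _ _) (≡.cong suc (length-filter-∁ xs))

      ∁D-resp : Respects (∁ D)
      ∁D-resp x≈y ¬dx dy = ¬dx (D-resp (sym x≈y) dy)

    record Partition (P : A → Set) (n : ℕ) : Set where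
      field
        #in #out : ℕ
        inside : HasCard (P ∩ D) #in
        outside : HasCard (P ∩ ∁ D) #out
        #in+#out : #in ℕ.+ #out ≡ n

    partition : ∀ {P n} → HasCard P n → Partition P n
    partition (xs , len , all , xs! , complete) = record
      { inside = filter D? xs , ≡.refl , All.zip (AllP.filter⁺ D? all , AllP.all-filter D? xs) ,
          UniqueP.filter⁺ S D? xs! , λ x p → MembershipP.∈-filter⁺ S D? D-resp (complete x (proj₁ p)) (proj₂ p)
      ; outside = filter (∁? D?) xs , ≡.refl , All.zip (AllP.filter⁺ (∁? D?) all , AllP.all-filter (∁? D?) xs) ,
          UniqueP.filter⁺ S (∁? D?) xs! , λ x p → MembershipP.∈-filter⁺ S (∁? D?) ∁D-resp (complete x (proj₁ p)) (proj₂ p)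
      ; #in+#out = ≡.trans (length-filter-∁ xs) len
      }

  hasCard-∪ : ∀ {P R : A → Set} {m n} → HasCard P m → HasCard R n → Respects R → (∀ {x} → P x → ¬ R x) →
    HasCard (P ∪ R) (m ℕ.+ n)
  hasCard-∪ {P} {R} (xs , ≡.refl , ps , xs! , xs-complete) (ys , ≡.refl , rs , ys! , ys-complete) R-resp disjoint =
    xs ++ ys , ListP.length-++ xs , AllP.++⁺ (All.map inj₁ ps) (All.map inj₂ rs) ,
    UniqueP.++⁺ S xs! ys! apart , complete
    where
    apart : ∀ {v} → ¬ (v ∈ xs × v ∈ ys)
    apart (v∈xs , v∈ys) with All.lookupAny ps v∈xs | All.lookupAny rs v∈ys
    ... | p , v≈x | r , v≈y = disjoint p (R-resp (trans (sym v≈y) v≈x) r)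
    complete : ∀ x → (P ∪ R) x → x ∈ xs ++ ys
    complete x (inj₁ p) = MembershipP.∈-++⁺ˡ S (xs-complete x p)
    complete x (inj₂ r) = MembershipP.∈-++⁺ʳ S xs (ys-complete x r)

module _ (S T : Setoid 0ℓ 0ℓ) where
  private
    module S = Setoid S
    module T = Setoid T
  open Counting
  open MembershipS T using () renaming (_∈_ to _∈T_)

  hasCard-≤ : ∀ {P R m n} → HasCard S P m → HasCard T R n → (f : S.Carrier → T.Carrier) →
    (∀ {x} → P x → R (f x)) → (∀ {x y} → P x → P y → f x T.≈ f y → x S.≈ y) → m ℕ.≤ n
  hasCard-≤ {P} (xs , ≡.refl , ps , xs! , _) (ys , ≡.refl , _ , _ , ys-complete) f f-R f-inj =
    FinP.injective⇒≤ {f = slot} slot-injective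
    where
    P-at : ∀ i → P (lookup xs i)
    P-at i = All.lookup ps (∈ₚP.∈-lookup i)
    slot-of : ∀ i → f (lookup xs i) ∈T ys
    slot-of i = ys-complete _ (f-R (P-at i))
    slot : Fin (length xs) → Fin (length ys)
    slot i = Any.index (slot-of i)
    slot-injective : ∀ {i j} → slot i ≡ slot j → i ≡ j
    slot-injective {i} {j} eq = lookup-injective S xs! i j
      (f-inj (P-at i) (P-at j) (MembershipP.index-injective T (slot-of i) (slot-of j) eq))

  hasCard-transport : ∀ {P R n} → HasCard S P n → (f : S.Carrier → T.Carrier) →
    (∀ {x} → P x → R (f x)) → (∀ {x y} → P x → P y → f x T.≈ f y → x S.≈ y) →
    (∀ {y} → R y → ∃ λ x → P x × y T.≈ f x) → (∀ {x y} → x S.≈ y → f x T.≈ f y) → HasCard T R n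
  hasCard-transport {P} {R} (xs , len , ps , xs! , xs-complete) f f-R f-inj f-onto f-cong =
    map f xs , ≡.trans (ListP.length-map f xs) len , AllP.map⁺ (All.map f-R ps) , unique ps xs! , complete
    where
    unique : ∀ {zs} → All P zs → UniqueS.Unique S zs → UniqueS.Unique T (map f zs)
    unique [] [] = []
    unique (p ∷ ps) (z∉zs ∷ zs!) =
      AllP.map⁺ (All.zipWith (λ (p′ , z≉z′) fz≈fz′ → z≉z′ (f-inj p p′ fz≈fz′)) (ps , z∉zs)) ∷ unique ps zs!
    complete : ∀ y → R y → y ∈T map f xs
    complete y r with f-onto r
    ... | x , p , y≈fx = MembershipP.∈-resp-≈ T (T.sym y≈fx) (MembershipP.∈-map⁺ S T f-cong (xs-complete x p))

  hasCard-× : ∀ {P R m n} → HasCard S P m → HasCard T R n →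
    HasCard (×-setoid S T) (λ p → P (proj₁ p) × R (proj₂ p)) (m ℕ.* n)
  hasCard-× (xs , ≡.refl , ps , xs! , xs-complete) (ys , ≡.refl , rs , ys! , ys-complete) =
    cartesianProduct xs ys , length-cartesianProduct xs ys ,
    AllP.cartesianProduct⁺ (≡.setoid _) (≡.setoid _) xs ys (λ x∈ y∈ → All.lookup ps x∈ , All.lookup rs y∈) ,
    UniqueP.cartesianProduct⁺ S T xs! ys! ,
    λ (x , y) (p , r) → MembershipP.∈-cartesianProduct⁺ S T (xs-complete x p) (ys-complete y r)

hasCard-unique : ∀ (S : Setoid 0ℓ 0ℓ) {P m n} → Counting.HasCard S P m → Counting.HasCard S P n → m ≡ n
hasCard-unique S a b = ℕP.≤-antisym (hasCard-≤ S S a b (λ x → x) (λ p → p) (λ _ _ e → e))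
                                    (hasCard-≤ S S b a (λ x → x) (λ p → p) (λ _ _ e → e))

module _ (S T : Setoid 0ℓ 0ℓ) where
  private
    module S = Setoid S
    module T = Setoid T
  open Counting

  injective⇒onto : ∀ {P R n} → HasCard S P n → HasCard T R n → (∀ a b → Dec (a T.≈ b)) →
    (f : S.Carrier → T.Carrier) → (∀ {x} → P x → R (f x)) → (∀ {x y} → P x → P y → f x T.≈ f y → x S.≈ y) →
    (∀ {x y} → x S.≈ y → f x T.≈ f y) → ∀ {y} → R y → ∃ λ x → P x × f x T.≈ y
  injective⇒onto {P} {R} {n} cP@(xs , _ , ps , _ , xs-complete) cR _≟_ f f-R f-inj f-cong {y} r
    with Any.any? (λ x → f x ≟ y) xs
  ... | yes hit = Any.lookup hit , All.lookupAny ps hit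
  ... | no miss = ⊥-elim (ℕP.<-irrefl ≡.refl n<n)
    where
    ≈y-resp : Respects T (T._≈ y)
    ≈y-resp a≈b a≈y = T.trans (T.sym a≈b) a≈y
    open Partition (partition T (_≟ y) ≈y-resp cR)
    misses-f : ∀ {x} → P x → ¬ f x T.≈ y
    misses-f p fx≈y = miss (Any.map (λ x≈z → T.trans (T.sym (f-cong x≈z)) fx≈y) (xs-complete _ p))
    n≤#out : n ℕ.≤ #out
    n≤#out = hasCard-≤ S T cP outside f (λ p → f-R p , misses-f p) f-inj
    1+#out≡n : suc #out ≡ n
    1+#out≡n = ≡.trans (≡.cong (ℕ._+ #out) (≡.sym (hasCard-unique T inside (hasCard-singleton T y r)))) #in+#out
    n<n : n ℕ.< n
    n<n = ℕP.≤-trans (s≤s n≤#out) (ℕP.≤-reflexive 1+#out≡n)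

module _ (S : Setoid 0ℓ 0ℓ) where
  open Setoid S
  open Counting S

  pigeonhole-∩ : ∀ {P R : Carrier → Set} {N m n} → HasCard (λ _ → ⊤) N → HasCard P m → HasCard R n →
    Respects P → Respects R → (∀ x → Dec (P x × R x)) → N ℕ.< m ℕ.+ n → ∃ λ x → P x × R x
  pigeonhole-∩ {P} {R} all@(xs , _ , _ , _ , xs-complete) cP cR P-resp R-resp PR? N<m+n with Any.any? PR? xs
  ... | yes hit = Any.lookup hit , AnyP.lookup-result hit
  ... | no miss = ⊥-elim (ℕP.<⇒≱ N<m+n
        (hasCard-≤ S S (hasCard-∪ cP cR R-resp disjoint) all (λ x → x) (λ _ → tt) (λ _ _ x≈y → x≈y)))
    where
    disjoint : ∀ {x} → P x → ¬ R x
    disjoint {x} p r = miss (Any.map (λ x≈y → P-resp x≈y p , R-resp x≈y r) (xs-complete x tt))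

module IntegerCoefficientSolver (R : CommutativeRing 0ℓ 0ℓ) where
  open CommutativeRing R
  open import Algebra.Properties.Ring ring using (-‿involutive; -‿distribˡ-*; -‿distribʳ-*; -0#≈0#; -‿+-comm)
  open import Algebra.Properties.Semiring.Mult.TCOptimised semiring using (1+×; ×-homo-+; ×1-homo-*) renaming (_×_ to _×ₙ_)
  open SetoidReasoning setoid

  ⟦_⟧ : ℤ → Carrier
  ⟦ + n ⟧ = n ×ₙ 1#
  ⟦ -[1+ n ] ⟧ = - (suc n ×ₙ 1#)

  private
    1+a-[1+b]≈a-b : ∀ a b → (1# + a) - (1# + b) ≈ a - b
    1+a-[1+b]≈a-b a b = begin
      (1# + a) + - (1# + b) ≈⟨ +-congˡ (sym (-‿+-comm 1# b)) ⟩
      (1# + a) + (- 1# + - b) ≈⟨ +-congʳ (+-comm 1# a) ⟩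
      (a + 1#) + (- 1# + - b) ≈⟨ +-assoc a 1# _ ⟩
      a + (1# + (- 1# + - b)) ≈⟨ +-congˡ (sym (+-assoc 1# (- 1#) (- b))) ⟩
      a + ((1# - 1#) + - b) ≈⟨ +-congˡ (+-congʳ (-‿inverseʳ 1#)) ⟩
      a + (0# + - b) ≈⟨ +-congˡ (+-identityˡ (- b)) ⟩
      a - b ∎

  ⊖-homo : ∀ m n → ⟦ m ⊖ n ⟧ ≈ m ×ₙ 1# - n ×ₙ 1#
  ⊖-homo zero zero = sym (-‿inverseʳ 0#)
  ⊖-homo (suc m) zero = sym (trans (+-congˡ -0#≈0#) (+-identityʳ _))
  ⊖-homo zero (suc n) = sym (+-identityˡ _)
  ⊖-homo (suc m) (suc n) = begin
    ⟦ suc m ⊖ suc n ⟧ ≡⟨ ≡.cong ⟦_⟧ (ℤP.[1+m]⊖[1+n]≡m⊖n m n) ⟩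
    ⟦ m ⊖ n ⟧ ≈⟨ ⊖-homo m n ⟩
    m ×ₙ 1# - n ×ₙ 1# ≈⟨ 1+a-[1+b]≈a-b (m ×ₙ 1#) (n ×ₙ 1#) ⟨
    (1# + m ×ₙ 1#) - (1# + n ×ₙ 1#) ≈⟨ +-cong (1+× m 1#) (-‿cong (1+× n 1#)) ⟨
    suc m ×ₙ 1# - suc n ×ₙ 1# ∎

  +-homo : ∀ i j → ⟦ i ℤ.+ j ⟧ ≈ ⟦ i ⟧ + ⟦ j ⟧
  +-homo (+ m) (+ n) = ×-homo-+ 1# m n
  +-homo (+ m) -[1+ n ] = ⊖-homo m (suc n)
  +-homo -[1+ m ] (+ n) = trans (⊖-homo n (suc m)) (+-comm _ _)
  +-homo -[1+ m ] -[1+ n ] = begin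
    - (suc (suc (m ℕ.+ n)) ×ₙ 1#) ≡⟨ ≡.cong (λ k → - (k ×ₙ 1#)) (ℕP.+-suc (suc m) n) ⟨
    - ((suc m ℕ.+ suc n) ×ₙ 1#) ≈⟨ -‿cong (×-homo-+ 1# (suc m) (suc n)) ⟩
    - (suc m ×ₙ 1# + suc n ×ₙ 1#) ≈⟨ -‿+-comm _ _ ⟨
    - (suc m ×ₙ 1#) + - (suc n ×ₙ 1#) ∎

  -‿homo : ∀ i → ⟦ ℤ.- i ⟧ ≈ - ⟦ i ⟧
  -‿homo (+ zero) = sym -0#≈0#
  -‿homo (+ suc n) = refl
  -‿homo -[1+ n ] = sym (-‿involutive _)

  *-homo : ∀ i j → ⟦ i ℤ.* j ⟧ ≈ ⟦ i ⟧ * ⟦ j ⟧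
  *-homo (+ zero) (+ n) = sym (zeroˡ _)
  *-homo (+ suc m) (+ zero) = trans (≡.subst (λ k → ⟦ Sign.+ ◃ k ⟧ ≈ 0#) (≡.sym (ℕP.*-zeroʳ m)) refl) (sym (zeroʳ _))
  *-homo (+ suc m) (+ suc n) = ×1-homo-* (suc m) (suc n)
  *-homo (+ zero) -[1+ n ] = sym (zeroˡ _)
  *-homo (+ suc m) -[1+ n ] = trans (-‿cong (×1-homo-* (suc m) (suc n))) (-‿distribʳ-* _ _)
  *-homo -[1+ m ] (+ zero) = trans (≡.subst (λ k → ⟦ Sign.- ◃ k ⟧ ≈ 0#) (≡.sym (ℕP.*-zeroʳ m)) refl) (sym (zeroʳ _))
  *-homo -[1+ m ] (+ suc n) = trans (-‿cong (×1-homo-* (suc m) (suc n))) (-‿distribˡ-* _ _)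
  *-homo -[1+ m ] -[1+ n ] = begin
    (suc m ℕ.* suc n) ×ₙ 1# ≈⟨ ×1-homo-* (suc m) (suc n) ⟩
    suc m ×ₙ 1# * suc n ×ₙ 1# ≈⟨ -‿involutive _ ⟨
    - - (suc m ×ₙ 1# * suc n ×ₙ 1#) ≈⟨ -‿cong (-‿distribˡ-* _ _) ⟩
    - ((- (suc m ×ₙ 1#)) * suc n ×ₙ 1#) ≈⟨ -‿distribʳ-* _ _ ⟩
    (- (suc m ×ₙ 1#)) * (- (suc n ×ₙ 1#)) ∎

  ℤ-homomorphism : ACR._-Raw-AlmostCommutative⟶_ ℤ.+-*-rawRing (ACR.fromCommutativeRing R)
  ℤ-homomorphism = record
    { ⟦_⟧ = ⟦_⟧ ; +-homo = +-homo ; *-homo = *-homo ; -‿homo = -‿homo ; 0-homo = refl ; 1-homo = refl }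

  private
    ≟-coefficients : ∀ a b → Maybe (⟦ a ⟧ ≈ ⟦ b ⟧)
    ≟-coefficients a b with a ℤ.≟ b
    ... | yes ≡.refl = just refl
    ... | no _ = nothing

  open RingSolver ℤ.+-*-rawRing (ACR.fromCommutativeRing R) ℤ-homomorphism ≟-coefficients public
    using (solve; _:=_; Polynomial)
    renaming (_:+_ to _⊕_; _:*_ to _⊗_; :-_ to ⊝_; con to κ)

  𝟘 𝟙 : ∀ {n} → Polynomial n
  𝟘 = κ (+ 0)
  𝟙 = κ (+ 1)

module FieldFacts (F : FiniteField) where
  open FiniteField F public
  open import Algebra.Properties.Ring ring public using (-‿involutive; -‿distribˡ-*; -‿distribʳ-*; -0#≈0#)
  open IntegerCoefficientSolver commRing public using (solve; _:=_; _⊕_; _⊗_; ⊝_; κ; 𝟘; 𝟙)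
  open PG3 F using (IsSquare)
  open SetoidReasoning setoid

  inv : (x : Carrier) → ¬ x ≈ 0# → Carrier
  inv x x≉0 = proj₁ (inverse x x≉0)

  *-inverseʳ : ∀ x (x≉0 : ¬ x ≈ 0#) → x * inv x x≉0 ≈ 1#
  *-inverseʳ x x≉0 = proj₂ (inverse x x≉0)

  *-inverseˡ : ∀ x (x≉0 : ¬ x ≈ 0#) → inv x x≉0 * x ≈ 1#
  *-inverseˡ x x≉0 = trans (*-comm _ _) (*-inverseʳ x x≉0)

  inv-cong : ∀ {x y} (x≉0 : ¬ x ≈ 0#) (y≉0 : ¬ y ≈ 0#) → x ≈ y → inv x x≉0 ≈ inv y y≉0
  inv-cong {x} {y} x≉0 y≉0 x≈y = begin
    inv x x≉0 ≈⟨ *-identityʳ _ ⟨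
    inv x x≉0 * 1# ≈⟨ *-congˡ (*-inverseʳ y y≉0) ⟨
    inv x x≉0 * (y * inv y y≉0) ≈⟨ *-assoc _ _ _ ⟨
    (inv x x≉0 * y) * inv y y≉0 ≈⟨ *-congʳ (trans (*-congˡ (sym x≈y)) (*-inverseˡ x x≉0)) ⟩
    1# * inv y y≉0 ≈⟨ *-identityˡ _ ⟩
    inv y y≉0 ∎

  *-cancelˡ-zero : ∀ {x y} → ¬ x ≈ 0# → x * y ≈ 0# → y ≈ 0#
  *-cancelˡ-zero {x} {y} x≉0 xy≈0 = begin
    y ≈⟨ *-identityˡ y ⟨
    1# * y ≈⟨ *-congʳ (*-inverseˡ x x≉0) ⟨
    (inv x x≉0 * x) * y ≈⟨ *-assoc _ _ _ ⟩
    inv x x≉0 * (x * y) ≈⟨ *-congˡ xy≈0 ⟩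
    inv x x≉0 * 0# ≈⟨ zeroʳ _ ⟩
    0# ∎

  zero-product : ∀ {x y} → x * y ≈ 0# → x ≈ 0# ⊎ y ≈ 0#
  zero-product {x} xy≈0 with x ≟ 0#
  ... | yes x≈0 = inj₁ x≈0
  ... | no x≉0 = inj₂ (*-cancelˡ-zero x≉0 xy≈0)

  *-cancelʳ-zero : ∀ {x y} → ¬ y ≈ 0# → x * y ≈ 0# → x ≈ 0#
  *-cancelʳ-zero y≉0 xy≈0 = *-cancelˡ-zero y≉0 (trans (*-comm _ _) xy≈0)

  *-nonzero : ∀ {x y} → ¬ x ≈ 0# → ¬ y ≈ 0# → ¬ x * y ≈ 0#
  *-nonzero x≉0 y≉0 xy≈0 = y≉0 (*-cancelˡ-zero x≉0 xy≈0)

  x-y≈0⇒x≈y : ∀ {x y} → x - y ≈ 0# → x ≈ y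
  x-y≈0⇒x≈y {x} {y} x-y≈0 = begin
    x ≈⟨ solve 2 (λ x y → x := (x ⊕ (⊝ y)) ⊕ y) refl x y ⟩
    (x - y) + y ≈⟨ +-congʳ x-y≈0 ⟩
    0# + y ≈⟨ +-identityˡ y ⟩
    y ∎

  x+y≈0⇒y≈-x : ∀ {x y} → x + y ≈ 0# → y ≈ - x
  x+y≈0⇒y≈-x {x} {y} x+y≈0 = begin
    y ≈⟨ solve 2 (λ x y → y := (x ⊕ y) ⊕ (⊝ x)) refl x y ⟩
    (x + y) + - x ≈⟨ +-congʳ x+y≈0 ⟩
    0# + - x ≈⟨ +-identityˡ _ ⟩
    - x ∎

  *-cancelˡ : ∀ {x y z} → ¬ x ≈ 0# → x * y ≈ x * z → y ≈ z
  *-cancelˡ {x} {y} {z} x≉0 xy≈xz = x-y≈0⇒x≈y (*-cancelˡ-zero x≉0 (begin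
    x * (y - z) ≈⟨ solve 3 (λ x y z → x ⊗ (y ⊕ (⊝ z)) := x ⊗ y ⊕ (⊝ (x ⊗ z))) refl x y z ⟩
    x * y - x * z ≈⟨ +-congʳ xy≈xz ⟩
    x * z - x * z ≈⟨ -‿inverseʳ _ ⟩
    0# ∎))

  x²≈y²⇒x≈±y : ∀ {x y} → x * x ≈ y * y → x ≈ y ⊎ x ≈ - y
  x²≈y²⇒x≈±y {x} {y} x²≈y² with zero-product {x - y} {x + y} (begin
    (x - y) * (x + y) ≈⟨ solve 2 (λ x y → (x ⊕ (⊝ y)) ⊗ (x ⊕ y) := x ⊗ x ⊕ (⊝ (y ⊗ y))) refl x y ⟩
    x * x - y * y ≈⟨ +-congʳ x²≈y² ⟩
    y * y - y * y ≈⟨ -‿inverseʳ _ ⟩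
    0# ∎)
  ... | inj₁ x-y≈0 = inj₁ (x-y≈0⇒x≈y x-y≈0)
  ... | inj₂ x+y≈0 = inj₂ (x-y≈0⇒x≈y (trans (+-congˡ (-‿involutive y)) x+y≈0))

  x≈-x⇒x≈0 : ∀ {x} → x ≈ - x → x ≈ 0#
  x≈-x⇒x≈0 {x} x≈-x = *-cancelˡ-zero odd (begin
    (1# + 1#) * x ≈⟨ solve 1 (λ x → (𝟙 ⊕ 𝟙) ⊗ x := x ⊕ x) refl x ⟩
    x + x ≈⟨ +-congˡ x≈-x ⟩
    x - x ≈⟨ -‿inverseʳ x ⟩
    0# ∎)

  ≈-stable : ∀ {x y} → ¬ ¬ x ≈ y → x ≈ y
  ≈-stable {x} {y} ¬¬x≈y with x ≟ y
  ... | yes x≈y = x≈y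
  ... | no x≉y = ⊥-elim (¬¬x≈y x≉y)

  x*x≈0⇒x≈0 : ∀ {x} → x * x ≈ 0# → x ≈ 0#
  x*x≈0⇒x≈0 x²≈0 = ≈-stable λ x≉0 → *-nonzero x≉0 x≉0 x²≈0

  ∈-elements : ∀ {P : Carrier → Set} → (∀ {x y} → x ≈ y → P x → P y) → ∀ {x} → P x → Any P elements
  ∈-elements P-resp {x} px = Any.map (λ x≈y → P-resp x≈y px) (complete x)

  isSquare-resp : ∀ {a b} → a ≈ b → IsSquare a → IsSquare b
  isSquare-resp a≈b (r , r²≈a) = r , trans r²≈a a≈b

  isSquare? : ∀ a → Dec (IsSquare a)
  isSquare? a with Any.any? (λ r → (r * r) ≟ a) elements
  ... | yes hit = yes (Any.lookup hit , AnyP.lookup-result hit)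
  ... | no miss = no λ (r , r²≈a) → miss (∈-elements (λ x≈y x²≈a → trans (*-cong (sym x≈y) (sym x≈y)) x²≈a) r²≈a)

  nonSquare⇒≉0 : ∀ {a} → ¬ IsSquare a → ¬ a ≈ 0#
  nonSquare⇒≉0 ¬□a a≈0 = ¬□a (0# , trans (zeroˡ 0#) (sym a≈0))

  isSquare-* : ∀ {a b} → IsSquare a → IsSquare b → IsSquare (a * b)
  isSquare-* (x , x²≈a) (y , y²≈b) =
    x * y , trans (solve 2 (λ x y → (x ⊗ y) ⊗ (x ⊗ y) := (x ⊗ x) ⊗ (y ⊗ y)) refl x y) (*-cong x²≈a y²≈b)

  isSquare-*ˡ : ∀ {l a} → IsSquare a → IsSquare ((l * l) * a)
  isSquare-*ˡ {l} = isSquare-* (l , refl)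

  isSquare-/ˡ : ∀ {l a} → ¬ l ≈ 0# → IsSquare ((l * l) * a) → IsSquare a
  isSquare-/ˡ {l} {a} l≉0 □l²a = isSquare-resp (begin
    (l⁻¹ * l⁻¹) * ((l * l) * a) ≈⟨ solve 3 (λ i l a → (i ⊗ i) ⊗ ((l ⊗ l) ⊗ a) := ((i ⊗ l) ⊗ (i ⊗ l)) ⊗ a) refl l⁻¹ l a ⟩
    ((l⁻¹ * l) * (l⁻¹ * l)) * a ≈⟨ *-congʳ (*-cong (*-inverseˡ l l≉0) (*-inverseˡ l l≉0)) ⟩
    (1# * 1#) * a ≈⟨ trans (*-congʳ (*-identityˡ 1#)) (*-identityˡ a) ⟩
    a ∎) (isSquare-*ˡ □l²a)
    where l⁻¹ = inv l l≉0

  nonSquare-*ˡ : ∀ {s a} → ¬ s ≈ 0# → IsSquare s → ¬ IsSquare a → ¬ IsSquare (s * a)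
  nonSquare-*ˡ {s} {a} s≉0 (r , r²≈s) ¬□a □sa = ¬□a (isSquare-/ˡ r≉0 (isSquare-resp (*-congʳ (sym r²≈s)) □sa))
    where
    r≉0 : ¬ r ≈ 0#
    r≉0 r≈0 = s≉0 (trans (sym r²≈s) (trans (*-congʳ r≈0) (zeroˡ r)))

module Squares (F : FiniteField) where
  open FieldFacts F
  open PG3 F using (IsSquare)
  open Counting setoid
  open SetoidReasoning setoid

  private
    root-in : List Carrier → Carrier → Carrier
    root-in [] a = 0#
    root-in (r ∷ rs) a with (r * r) ≟ a
    ... | yes _ = r
    ... | no _ = root-in rs a

    root-in-square : ∀ rs a → Any (λ r → r * r ≈ a) rs → root-in rs a * root-in rs a ≈ a
    root-in-square (r ∷ rs) a hit with (r * r) ≟ a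
    ... | yes r²≈a = r²≈a
    root-in-square (r ∷ rs) a (here r²≈a) | no r²≉a = ⊥-elim (r²≉a r²≈a)
    root-in-square (r ∷ rs) a (there hit) | no _ = root-in-square rs a hit

    root-in-cong : ∀ rs {a b} → a ≈ b → root-in rs a ≈ root-in rs b
    root-in-cong [] a≈b = refl
    root-in-cong (r ∷ rs) {a} {b} a≈b with (r * r) ≟ a | (r * r) ≟ b
    ... | yes _ | yes _ = refl
    ... | yes r²≈a | no r²≉b = ⊥-elim (r²≉b (trans r²≈a a≈b))
    ... | no r²≉a | yes r²≈b = ⊥-elim (r²≉a (trans r²≈b (sym a≈b)))
    ... | no _ | no _ = root-in-cong rs a≈b

  -- A square root found by search through the elements; junk value 0# on non-squares.
  √ : Carrier → Carrier
  √ = root-in elements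

  √-square : ∀ {a} → IsSquare a → √ a * √ a ≈ a
  √-square {a} (r , r²≈a) =
    root-in-square elements a (∈-elements (λ r≈s r²≈a → trans (*-cong (sym r≈s) (sym r≈s)) r²≈a) r²≈a)

  √-cong : ∀ {a b} → a ≈ b → √ a ≈ √ b
  √-cong = root-in-cong elements

  Nonzero : Carrier → Set
  Nonzero x = ¬ x ≈ 0#

  hasCard-elements : HasCard (λ _ → ⊤) order
  hasCard-elements = elements , ≡.refl , All.tabulate (λ _ → tt) , distinct , λ x _ → complete x

  private
    zero? = partition (_≟ 0#) (λ x≈y x≈0 → trans (sym x≈y) x≈0) hasCard-elements
    module Zero? = Partition zero?

  opaque
    #nonzero : ℕ
    #nonzero = Zero?.#out

    hasCard-nonzero : HasCard Nonzero #nonzero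
    hasCard-nonzero = hasCard-cong proj₂ (tt ,_) Zero?.outside

    1+#nonzero≡order : suc #nonzero ≡ order
    1+#nonzero≡order = ≡.trans (≡.cong (ℕ._+ Zero?.#out) (≡.sym #zero≡1)) Zero?.#in+#out
      where
      #zero≡1 : Zero?.#in ≡ 1
      #zero≡1 = hasCard-unique setoid Zero?.inside (hasCard-singleton 0# tt)

  private
    square? = partition isSquare? isSquare-resp hasCard-nonzero
    module Square? = Partition square?

  opaque
    #squares : ℕ
    #squares = Square?.#in

    #nonsquares : ℕ
    #nonsquares = Square?.#out

    hasCard-squares : HasCard (Nonzero ∩ IsSquare) #squares
    hasCard-squares = Square?.inside

    hasCard-nonsquares : HasCard (Nonzero ∩ ∁ IsSquare) #nonsquares
    hasCard-nonsquares = Square?.outside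

    #squares+#nonsquares : #squares ℕ.+ #nonsquares ≡ #nonzero
    #squares+#nonsquares = Square?.#in+#out

  -- x ↦ (x², whether x = √ x²) matches the non-zero elements with two copies of the non-zero squares.
  private
    Signs : Setoid 0ℓ 0ℓ
    Signs = ≡.setoid Bool

    hasCard-signs : Counting.HasCard Signs (λ _ → ⊤) 2
    hasCard-signs = true ∷ false ∷ [] , ≡.refl , tt ∷ tt ∷ [] , ((λ ()) ∷ []) ∷ [] ∷ [] ,
      λ { true _ → here ≡.refl ; false _ → there (here ≡.refl) }

    SignedSquares = ×-setoid setoid Signs
    module SignedSquares = Setoid SignedSquares

    hasCard-signedSquares : Counting.HasCard SignedSquares (λ p → (Nonzero ∩ IsSquare) (proj₁ p) × ⊤) (#squares ℕ.* 2)
    hasCard-signedSquares = hasCard-× setoid Signs hasCard-squares hasCard-signs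

    -x*-x≈x*x : ∀ x → (- x) * (- x) ≈ x * x
    -x*-x≈x*x x = solve 1 (λ x → (⊝ x) ⊗ (⊝ x) := x ⊗ x) refl x

    square-with-sign : Carrier → Carrier × Bool
    square-with-sign x = x * x , does (x ≟ √ (x * x))

    signed-root : Carrier × Bool → Carrier
    signed-root (s , true) = √ s
    signed-root (s , false) = - √ s

    signed-root-square : ∀ {s} b → IsSquare s → signed-root (s , b) * signed-root (s , b) ≈ s
    signed-root-square true □s = √-square □s
    signed-root-square false □s = trans (-x*-x≈x*x _) (√-square □s)

    #nonzero≤2#squares : #nonzero ℕ.≤ #squares ℕ.* 2
    #nonzero≤2#squares = hasCard-≤ setoid SignedSquares hasCard-nonzero hasCard-signedSquares square-with-sign
      (λ {x} x≉0 → (*-nonzero x≉0 x≉0 , x , refl) , tt) injective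
      where
      injective : ∀ {x y} → Nonzero x → Nonzero y → square-with-sign x SignedSquares.≈ square-with-sign y → x ≈ y
      injective {x} {y} _ _ (x²≈y² , signs) with x ≟ √ (x * x) | y ≟ √ (y * y)
      ... | yes x≈√x² | yes y≈√y² = trans x≈√x² (trans (√-cong x²≈y²) (sym y≈√y²))
      ... | yes _ | no _ with () ← signs
      ... | no _ | yes _ with () ← signs
      ... | no x≉√x² | no y≉√y² with x²≈y²⇒x≈±y (sym (√-square (x , refl))) | x²≈y²⇒x≈±y (sym (√-square (y , refl)))
      ...   | inj₁ x≈√x² | _ = ⊥-elim (x≉√x² x≈√x²)
      ...   | _ | inj₁ y≈√y² = ⊥-elim (y≉√y² y≈√y²)
      ...   | inj₂ x≈-√x² | inj₂ y≈-√y² = trans x≈-√x² (trans (-‿cong (√-cong x²≈y²)) (sym y≈-√y²))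

    2#squares≤#nonzero : #squares ℕ.* 2 ℕ.≤ #nonzero
    2#squares≤#nonzero = hasCard-≤ SignedSquares setoid hasCard-signedSquares hasCard-nonzero signed-root
      (λ {(s , b)} ((s≉0 , □s) , _) r≈0 → s≉0 (trans (sym (signed-root-square b □s)) (trans (*-congʳ r≈0) (zeroˡ _))))
      injective
      where
      injective : ∀ {p p′} → (Nonzero ∩ IsSquare) (proj₁ p) × ⊤ → (Nonzero ∩ IsSquare) (proj₁ p′) × ⊤ →
        signed-root p ≈ signed-root p′ → p SignedSquares.≈ p′
      injective {s , b} {s′ , b′} ((s≉0 , □s) , _) ((_ , □s′) , _) r≈r′ = s≈s′ , same-sign b b′ r≈r′
        where
        s≈s′ : s ≈ s′
        s≈s′ = trans (sym (signed-root-square b □s)) (trans (*-cong r≈r′ r≈r′) (signed-root-square b′ □s′))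
        √s≉0 : ¬ √ s ≈ 0#
        √s≉0 √s≈0 = s≉0 (trans (sym (√-square □s)) (trans (*-congʳ √s≈0) (zeroˡ _)))
        same-sign : ∀ b b′ → signed-root (s , b) ≈ signed-root (s′ , b′) → b ≡ b′
        same-sign true true _ = ≡.refl
        same-sign false false _ = ≡.refl
        same-sign true false e = ⊥-elim (√s≉0 (x≈-x⇒x≈0 (trans e (-‿cong (√-cong (sym s≈s′))))))
        same-sign false true e = ⊥-elim (√s≉0 (x≈-x⇒x≈0 (trans (√-cong s≈s′) (sym e))))

  #nonsquares≡#squares : #nonsquares ≡ #squares
  #nonsquares≡#squares = ℕP.+-cancelˡ-≡ #squares #nonsquares #squares
    (≡.trans #squares+#nonsquares (≡.trans (ℕP.≤-antisym #nonzero≤2#squares 2#squares≤#nonzero) (n*2≡n+n #squares)))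
    where
    n*2≡n+n : ∀ n → n ℕ.* 2 ≡ n ℕ.+ n
    n*2≡n+n n = ≡.trans (ℕP.*-comm n 2) (≡.cong (n ℕ.+_) (ℕP.+-identityʳ n))

  nonSquare-*-nonSquare : ∀ {a b} → ¬ IsSquare a → ¬ IsSquare b → IsSquare (a * b)
  nonSquare-*-nonSquare {a} {b} ¬□a ¬□b
    with injective⇒onto setoid setoid hasCard-squares
           (≡.subst (HasCard _) #nonsquares≡#squares hasCard-nonsquares) _≟_ (a *_)
           (λ (x≉0 , □x) → *-nonzero a≉0 x≉0 , λ □ax → nonSquare-*ˡ x≉0 □x ¬□a (isSquare-resp (*-comm a _) □ax))
           (λ _ _ ax≈ay → *-cancelˡ a≉0 ax≈ay) *-congˡ (nonSquare⇒≉0 ¬□b , ¬□b)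
    where a≉0 = nonSquare⇒≉0 ¬□a
  ... | s , (_ , □s) , as≈b = isSquare-resp (trans (*-assoc a a s) (*-congˡ as≈b)) (isSquare-*ˡ □s)

  hasCard-isSquare : HasCard IsSquare (#squares ℕ.+ 1)
  hasCard-isSquare = hasCard-cong to from
    (hasCard-∪ hasCard-squares (hasCard-singleton 0# tt) (λ x≈y (_ , x≈0) → tt , trans (sym x≈y) x≈0)
      λ (x≉0 , _) (_ , x≈0) → x≉0 x≈0)
    where
    to : (Nonzero ∩ IsSquare) ∪ ((λ _ → ⊤) ∩ (_≈ 0#)) ⊆ IsSquare
    to (inj₁ (_ , □x)) = □x
    to (inj₂ (_ , x≈0)) = 0# , trans (zeroˡ 0#) (sym x≈0)
    from : IsSquare ⊆ (Nonzero ∩ IsSquare) ∪ ((λ _ → ⊤) ∩ (_≈ 0#))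
    from {x} □x with x ≟ 0#
    ... | yes x≈0 = inj₂ (tt , x≈0)
    ... | no x≉0 = inj₁ (x≉0 , □x)

  order≡1+2#squares : order ≡ suc (#squares ℕ.+ #squares)
  order≡1+2#squares = ≡.trans (≡.sym 1+#nonzero≡order)
    (≡.cong suc (≡.trans (≡.sym #squares+#nonsquares) (≡.cong (#squares ℕ.+_) #nonsquares≡#squares)))

  -- The sets {t | t square} and {t | (t - w)/w square} both have (q + 1)/2 elements, so they meet.
  norm-surjective : ∀ w → ¬ IsSquare w → ∃₂ λ a b → a * a - w * (b * b) ≈ w
  norm-surjective w ¬□w = conclude (pigeonhole-∩ setoid hasCard-elements hasCard-isSquare hasCard-shifted
    isSquare-resp shifted-resp (λ t → isSquare? t ×-dec isSquare? (shift t)) q<2[k+1])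
    where
    open import Relation.Nullary using (_×-dec_)
    w≉0 = nonSquare⇒≉0 ¬□w
    w⁻¹ = inv w w≉0
    shift : Carrier → Carrier
    shift t = (t - w) * w⁻¹
    shifted-resp : Respects (λ t → IsSquare (shift t))
    shifted-resp t≈u = isSquare-resp (*-congʳ (+-congʳ t≈u))
    w[d/w]≈d : ∀ d → w * (d * w⁻¹) ≈ d
    w[d/w]≈d d = trans (solve 3 (λ w d i → w ⊗ (d ⊗ i) := d ⊗ (w ⊗ i)) refl w d w⁻¹)
                       (trans (*-congˡ (*-inverseʳ w w≉0)) (*-identityʳ d))
    unshift : Carrier → Carrier
    unshift t = w * t + w
    shift-unshift : ∀ t → shift (unshift t) ≈ t
    shift-unshift t = begin
      ((w * t + w) - w) * w⁻¹ ≈⟨ solve 3 (λ w t i → ((w ⊗ t ⊕ w) ⊕ (⊝ w)) ⊗ i := w ⊗ (t ⊗ i)) refl w t w⁻¹ ⟩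
      w * (t * w⁻¹) ≈⟨ w[d/w]≈d t ⟩
      t ∎
    hasCard-shifted : HasCard (λ t → IsSquare (shift t)) (#squares ℕ.+ 1)
    hasCard-shifted = hasCard-transport setoid setoid hasCard-isSquare unshift
      (λ {t} □t → isSquare-resp (sym (shift-unshift t)) □t)
      (λ {t} {u} _ _ e → trans (sym (shift-unshift t)) (trans (*-congʳ (+-congʳ e)) (shift-unshift u)))
      (λ {u} □ → shift u , □ , (begin
        u ≈⟨ solve 2 (λ u w → u := (u ⊕ (⊝ w)) ⊕ w) refl u w ⟩
        (u - w) + w ≈⟨ +-congʳ (w[d/w]≈d (u - w)) ⟨
        unshift (shift u) ∎))
      (λ t≈u → +-congʳ (*-congˡ t≈u))
    q<2[k+1] : order ℕ.< (#squares ℕ.+ 1) ℕ.+ (#squares ℕ.+ 1)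
    q<2[k+1] = ℕP.≤-reflexive (≡.trans (≡.cong suc order≡1+2#squares) (≡.sym
      (≡.trans (≡.cong₂ ℕ._+_ (ℕP.+-comm #squares 1) (ℕP.+-comm #squares 1)) (≡.cong suc (ℕP.+-suc #squares #squares)))))
    conclude : (∃ λ t → IsSquare t × IsSquare (shift t)) → ∃₂ λ a b → a * a - w * (b * b) ≈ w
    conclude (t , (a , a²≈t) , (b , b²≈shift)) = a , b , (begin
      a * a - w * (b * b) ≈⟨ +-cong a²≈t (-‿cong (*-congˡ b²≈shift)) ⟩
      t - w * shift t ≈⟨ +-congˡ (-‿cong (w[d/w]≈d (t - w))) ⟩
      t - (t - w) ≈⟨ solve 2 (λ t w → t ⊕ (⊝ (t ⊕ (⊝ w))) := w) refl t w ⟩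
      w ∎)

module NormForm (F : FiniteField) (ω : FiniteField.Carrier F) (¬□ω : ¬ PG3.IsSquare F ω) where
  open FieldFacts F
  open Squares F using (nonSquare-*-nonSquare; norm-surjective)
  open PG3 F using (IsSquare)
  open SetoidReasoning setoid

  Pairs : Setoid 0ℓ 0ℓ
  Pairs = ×-setoid setoid setoid
  open Setoid Pairs public using () renaming (_≈_ to _≈₂_)
  open Counting Pairs using (HasCard; hasCard-cong; hasCard-∪; hasCard-singleton)

  Pair : Set
  Pair = Carrier × Carrier

  norm : Pair → Carrier
  norm (a , b) = a * a - ω * (b * b)

  norm-cong : ∀ {c c′} → c ≈₂ c′ → norm c ≈ norm c′
  norm-cong (a≈a′ , b≈b′) = +-cong (*-cong a≈a′ a≈a′) (-‿cong (*-congˡ (*-cong b≈b′ b≈b′)))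

  ω≉0 : ¬ ω ≈ 0#
  ω≉0 = nonSquare⇒≉0 ¬□ω

  NonZeroPair : Pair → Set
  NonZeroPair (a , b) = ¬ (a ≈ 0# × b ≈ 0#)

  norm≈0⇒zero : ∀ {a b} → norm (a , b) ≈ 0# → a ≈ 0# × b ≈ 0#
  norm≈0⇒zero {a} {b} N≈0 with b ≟ 0#
  ... | yes b≈0 = x*x≈0⇒x≈0 (begin
      a * a ≈⟨ solve 3 (λ a b w → a ⊗ a := (a ⊗ a ⊕ (⊝ (w ⊗ (b ⊗ b)))) ⊕ w ⊗ (b ⊗ b)) refl a b ω ⟩
      norm (a , b) + ω * (b * b) ≈⟨ +-cong N≈0 (*-congˡ (trans (*-congʳ b≈0) (zeroˡ b))) ⟩
      0# + ω * 0# ≈⟨ trans (+-identityˡ _) (zeroʳ ω) ⟩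
      0# ∎) , b≈0
  ... | no b≉0 = ⊥-elim (¬□ω (a * b⁻¹ , (begin
      (a * b⁻¹) * (a * b⁻¹) ≈⟨ solve 2 (λ a i → (a ⊗ i) ⊗ (a ⊗ i) := (a ⊗ a) ⊗ (i ⊗ i)) refl a b⁻¹ ⟩
      (a * a) * (b⁻¹ * b⁻¹) ≈⟨ *-congʳ (x-y≈0⇒x≈y N≈0) ⟩
      (ω * (b * b)) * (b⁻¹ * b⁻¹) ≈⟨ solve 3 (λ w b i → (w ⊗ (b ⊗ b)) ⊗ (i ⊗ i) := w ⊗ ((b ⊗ i) ⊗ (b ⊗ i))) refl ω b b⁻¹ ⟩
      ω * ((b * b⁻¹) * (b * b⁻¹)) ≈⟨ *-congˡ (*-cong (*-inverseʳ b b≉0) (*-inverseʳ b b≉0)) ⟩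
      ω * (1# * 1#) ≈⟨ trans (*-congˡ (*-identityˡ 1#)) (*-identityʳ ω) ⟩
      ω ∎)))
    where b⁻¹ = inv b b≉0

  norm-nonzero : ∀ {c} → NonZeroPair c → ¬ norm c ≈ 0#
  norm-nonzero c≉0 N≈0 = c≉0 (norm≈0⇒zero N≈0)

  _·_ : Carrier → Pair → Pair
  l · (a , b) = l * a , l * b

  norm-· : ∀ l c → norm (l · c) ≈ (l * l) * norm c
  norm-· l (a , b) = solve 4 (λ l a b w → (l ⊗ a) ⊗ (l ⊗ a) ⊕ (⊝ (w ⊗ ((l ⊗ b) ⊗ (l ⊗ b))))
    := (l ⊗ l) ⊗ (a ⊗ a ⊕ (⊝ (w ⊗ (b ⊗ b))))) refl l a b ω

  det : Pair → Pair → Carrier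
  det (a , b) (c , d) = a * d - b * c

  det-cong : ∀ {x x′ y y′} → x ≈₂ x′ → y ≈₂ y′ → det x y ≈ det x′ y′
  det-cong (a≈ , b≈) (c≈ , d≈) = +-cong (*-cong a≈ d≈) (-‿cong (*-cong b≈ c≈))

  det-· : ∀ l l′ x y → det (l · x) (l′ · y) ≈ (l * l′) * det x y
  det-· l l′ (a , b) (c , d) = solve 6 (λ l m a b c d →
    (l ⊗ a) ⊗ (m ⊗ d) ⊕ (⊝ ((l ⊗ b) ⊗ (m ⊗ c))) := (l ⊗ m) ⊗ (a ⊗ d ⊕ (⊝ (b ⊗ c)))) refl l l′ a b c d

  det-self : ∀ x → det x x ≈ 0#
  det-self (a , b) = trans (+-congʳ (*-comm a b)) (-‿inverseʳ _)

  -- Normalised pairs (1, b) and (0, 1) represent the q + 1 points of PG(1, q).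
  Normalised : Pair → Set
  Normalised (a , b) = a ≈ 1# ⊎ (a ≈ 0# × b ≈ 1#)

  normalised-nonzero : ∀ {c} → Normalised c → NonZeroPair c
  normalised-nonzero (inj₁ a≈1) (a≈0 , _) = 1≉0 (trans (sym a≈1) a≈0)
  normalised-nonzero (inj₂ (_ , b≈1)) (_ , b≈0) = 1≉0 (trans (sym b≈1) b≈0)

  hasCard-normalised : HasCard Normalised (suc order)
  hasCard-normalised = ≡.subst (HasCard Normalised) (≡.trans (ℕP.+-comm (1 ℕ.* order) 1) (≡.cong suc (ℕP.*-identityˡ order)))
    (hasCard-cong to from
    (hasCard-∪ (hasCard-× setoid setoid (Counting.hasCard-singleton setoid 1# tt) (Squares.hasCard-elements F))
      (hasCard-singleton (0# , 1#) tt) (λ c≈c′ (_ , c≈) → tt , Setoid.trans Pairs (Setoid.sym Pairs c≈c′) c≈)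
      λ ((_ , a≈1) , _) (_ , (a≈0 , _)) → 1≉0 (trans (sym a≈1) a≈0)))
    where
    to : ∀ {c} → _ → Normalised c
    to (inj₁ ((_ , a≈1) , _)) = inj₁ a≈1
    to (inj₂ (_ , a≈0 , b≈1)) = inj₂ (a≈0 , b≈1)
    from : ∀ {c} → Normalised c → _
    from (inj₁ a≈1) = inj₁ ((tt , a≈1) , tt)
    from (inj₂ (a≈0 , b≈1)) = inj₂ (tt , a≈0 , b≈1)

  normalise : Pair → Pair
  normalise (a , b) with a ≟ 0#
  ... | yes _ = 0# , 1#
  ... | no a≉0 = 1# , b * inv a a≉0

  normalised-normalise : ∀ c → Normalised (normalise c)
  normalised-normalise (a , b) with a ≟ 0#
  ... | yes _ = inj₂ (refl , refl)
  ... | no _ = inj₁ refl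

  normalise-scale : ∀ c → NonZeroPair c → ∃ λ l → ¬ l ≈ 0# × c ≈₂ l · normalise c
  normalise-scale (a , b) c≉0 with a ≟ 0#
  ... | yes a≈0 = b , (λ b≈0 → c≉0 (a≈0 , b≈0)) , trans a≈0 (sym (zeroʳ b)) , sym (*-identityʳ b)
  ... | no a≉0 = a , a≉0 , sym (*-identityʳ a) , (begin
    b ≈⟨ *-identityˡ b ⟨
    1# * b ≈⟨ *-congʳ (*-inverseʳ a a≉0) ⟨
    (a * inv a a≉0) * b ≈⟨ solve 3 (λ a i b → (a ⊗ i) ⊗ b := a ⊗ (b ⊗ i)) refl a (inv a a≉0) b ⟩
    a * (b * inv a a≉0) ∎)

  normalise-cong : ∀ {c c′} → c ≈₂ c′ → normalise c ≈₂ normalise c′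
  normalise-cong {a , b} {a′ , b′} (a≈a′ , b≈b′) with a ≟ 0# | a′ ≟ 0#
  ... | yes _ | yes _ = refl , refl
  ... | yes a≈0 | no a′≉0 = ⊥-elim (a′≉0 (trans (sym a≈a′) a≈0))
  ... | no a≉0 | yes a′≈0 = ⊥-elim (a≉0 (trans a≈a′ a′≈0))
  ... | no a≉0 | no a′≉0 = refl , *-cong b≈b′ (inv-cong a≉0 a′≉0 a≈a′)

  normalise-normalised : ∀ {c} → Normalised c → normalise c ≈₂ c
  normalise-normalised {a , b} n with a ≟ 0# | n
  ... | yes a≈0 | inj₁ a≈1 = ⊥-elim (1≉0 (trans (sym a≈1) a≈0))
  ... | yes _ | inj₂ (a≈0 , b≈1) = sym a≈0 , sym b≈1
  ... | no a≉0 | inj₂ (a≈0 , _) = ⊥-elim (a≉0 a≈0)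
  ... | no a≉0 | inj₁ a≈1 = sym a≈1 , (begin
    b * inv a a≉0 ≈⟨ *-identityˡ _ ⟨
    1# * (b * inv a a≉0) ≈⟨ *-congʳ a≈1 ⟨
    a * (b * inv a a≉0) ≈⟨ solve 3 (λ a b i → a ⊗ (b ⊗ i) := b ⊗ (a ⊗ i)) refl a b (inv a a≉0) ⟩
    b * (a * inv a a≉0) ≈⟨ trans (*-congˡ (*-inverseʳ a a≉0)) (*-identityʳ b) ⟩
    b ∎)

  det≈0⇒≈ : ∀ {c c′} → Normalised c → Normalised c′ → det c c′ ≈ 0# → c ≈₂ c′
  det≈0⇒≈ {a , b} {a′ , b′} (inj₁ a≈1) (inj₁ a′≈1) d≈0 = trans a≈1 (sym a′≈1) , (begin
    b ≈⟨ *-identityʳ b ⟨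
    b * 1# ≈⟨ *-congˡ a′≈1 ⟨
    b * a′ ≈⟨ x-y≈0⇒x≈y d≈0 ⟨
    a * b′ ≈⟨ *-congʳ a≈1 ⟩
    1# * b′ ≈⟨ *-identityˡ b′ ⟩
    b′ ∎)
  det≈0⇒≈ {a , b} {a′ , b′} (inj₁ a≈1) (inj₂ (a′≈0 , b′≈1)) d≈0 = ⊥-elim (1≉0 (begin
    1# ≈⟨ *-identityˡ 1# ⟨
    1# * 1# ≈⟨ *-cong a≈1 b′≈1 ⟨
    a * b′ ≈⟨ x-y≈0⇒x≈y d≈0 ⟩
    b * a′ ≈⟨ trans (*-congˡ a′≈0) (zeroʳ b) ⟩
    0# ∎))
  det≈0⇒≈ {a , b} {a′ , b′} (inj₂ (a≈0 , b≈1)) (inj₁ a′≈1) d≈0 = ⊥-elim (1≉0 (begin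
    1# ≈⟨ *-identityˡ 1# ⟨
    1# * 1# ≈⟨ *-cong b≈1 a′≈1 ⟨
    b * a′ ≈⟨ x-y≈0⇒x≈y d≈0 ⟨
    a * b′ ≈⟨ trans (*-congʳ a≈0) (zeroˡ b′) ⟩
    0# ∎))
  det≈0⇒≈ (inj₂ (a≈0 , b≈1)) (inj₂ (a′≈0 , b′≈1)) _ = trans a≈0 (sym a′≈0) , trans b≈1 (sym b′≈1)

  det≈0⇒∝ : ∀ {r} a → Normalised r → det r a ≈ 0# → ∃ λ μ → proj₁ a ≈ μ * proj₁ r × proj₂ a ≈ μ * proj₂ r
  det≈0⇒∝ {r₁ , r₂} (a , b) (inj₁ r₁≈1) det≈0 = a , sym (trans (*-congˡ r₁≈1) (*-identityʳ a)) , (begin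
    b ≈⟨ *-identityˡ b ⟨
    1# * b ≈⟨ *-congʳ r₁≈1 ⟨
    r₁ * b ≈⟨ x-y≈0⇒x≈y det≈0 ⟩
    r₂ * a ≈⟨ *-comm _ _ ⟩
    a * r₂ ∎)
  det≈0⇒∝ {r₁ , r₂} (a , b) (inj₂ (r₁≈0 , r₂≈1)) det≈0 = b , (begin
    a ≈⟨ *-identityˡ a ⟨
    1# * a ≈⟨ *-congʳ r₂≈1 ⟨
    r₂ * a ≈⟨ x-y≈0⇒x≈y det≈0 ⟨
    r₁ * b ≈⟨ trans (*-congʳ r₁≈0) (zeroˡ b) ⟩
    0# ≈⟨ trans (sym (zeroʳ b)) (*-congˡ (sym r₁≈0)) ⟩
    b * r₁ ∎) , sym (trans (*-congˡ r₂≈1) (*-identityʳ b))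

  det-·ʳ : ∀ c l y → det c (l · y) ≈ l * det c y
  det-·ʳ (a , b) l (y₁ , y₂) = solve 5 (λ a b l y₁ y₂ → a ⊗ (l ⊗ y₂) ⊕ (⊝ (b ⊗ (l ⊗ y₁))) := l ⊗ (a ⊗ y₂ ⊕ (⊝ (b ⊗ y₁)))) refl a b l y₁ y₂

  -- Multiplication by an element γ of norm ω in GF(q²) = GF(q)(√ω) multiplies norms by ω,
  -- so on PG(1, q) it swaps the points of square norm with those of non-square norm.
  private opaque
    γ : Pair
    γ = proj₁ (norm-surjective ω ¬□ω) , proj₁ (proj₂ (norm-surjective ω ¬□ω))

    norm-γ : norm γ ≈ ω
    norm-γ = proj₂ (proj₂ (norm-surjective ω ¬□ω))

  private

    γ* : Pair → Pair
    γ* (a , b) = proj₁ γ * a + ω * (proj₂ γ * b) , proj₁ γ * b + proj₂ γ * a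

    norm-γ* : ∀ c → norm (γ* c) ≈ norm γ * norm c
    norm-γ* (a , b) = solve 5 (λ g h a b w →
      (g ⊗ a ⊕ w ⊗ (h ⊗ b)) ⊗ (g ⊗ a ⊕ w ⊗ (h ⊗ b)) ⊕ (⊝ (w ⊗ ((g ⊗ b ⊕ h ⊗ a) ⊗ (g ⊗ b ⊕ h ⊗ a))))
      := (g ⊗ g ⊕ (⊝ (w ⊗ (h ⊗ h)))) ⊗ (a ⊗ a ⊕ (⊝ (w ⊗ (b ⊗ b))))) refl (proj₁ γ) (proj₂ γ) a b ω

    det-γ* : ∀ c c′ → det (γ* c) (γ* c′) ≈ norm γ * det c c′
    det-γ* (a , b) (c , d) = solve 7 (λ g h a b c d w →
      (g ⊗ a ⊕ w ⊗ (h ⊗ b)) ⊗ (g ⊗ d ⊕ h ⊗ c) ⊕ (⊝ ((g ⊗ b ⊕ h ⊗ a) ⊗ (g ⊗ c ⊕ w ⊗ (h ⊗ d))))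
      := (g ⊗ g ⊕ (⊝ (w ⊗ (h ⊗ h)))) ⊗ (a ⊗ d ⊕ (⊝ (b ⊗ c)))) refl (proj₁ γ) (proj₂ γ) a b c d ω

    norm-γ≉0 : ¬ norm γ ≈ 0#
    norm-γ≉0 N≈0 = ω≉0 (trans (sym norm-γ) N≈0)

    γ*-nonzero : ∀ {c} → NonZeroPair c → NonZeroPair (γ* c)
    γ*-nonzero {c} c≉0 γc≈0 = *-nonzero norm-γ≉0 (norm-nonzero c≉0) (begin
      norm γ * norm c ≈⟨ norm-γ* c ⟨
      norm (γ* c) ≈⟨ norm-cong γc≈0 ⟩
      norm (0# , 0#) ≈⟨ solve 1 (λ w → 𝟘 ⊗ 𝟘 ⊕ (⊝ (w ⊗ (𝟘 ⊗ 𝟘))) := 𝟘) refl ω ⟩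
      0# ∎)

    φ : Pair → Pair
    φ c = normalise (γ* c)

    φ-injective : ∀ {c c′} → Normalised c → Normalised c′ → φ c ≈₂ φ c′ → c ≈₂ c′
    φ-injective {c} {c′} n n′ φc≈φc′ = det≈0⇒≈ n n′ (*-cancelˡ-zero norm-γ≉0 (begin
      norm γ * det c c′ ≈⟨ det-γ* c c′ ⟨
      det (γ* c) (γ* c′) ≈⟨ det-cong (proj₂ (proj₂ scaling)) (proj₂ (proj₂ scaling′)) ⟩
      det (l · φ c) (l′ · φ c′) ≈⟨ det-· l l′ (φ c) (φ c′) ⟩
      (l * l′) * det (φ c) (φ c′) ≈⟨ *-congˡ (det-cong (Setoid.refl Pairs) (Setoid.sym Pairs φc≈φc′)) ⟩
      (l * l′) * det (φ c) (φ c) ≈⟨ trans (*-congˡ (det-self (φ c))) (zeroʳ _) ⟩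
      0# ∎))
      where
      scaling = normalise-scale (γ* c) (γ*-nonzero (normalised-nonzero n))
      scaling′ = normalise-scale (γ* c′) (γ*-nonzero (normalised-nonzero n′))
      l = proj₁ scaling
      l′ = proj₁ scaling′

    ω*norm≈□*norm-φ : ∀ {c} → Normalised c → ∃ λ l → ¬ l ≈ 0# × ω * norm c ≈ (l * l) * norm (φ c)
    ω*norm≈□*norm-φ {c} n = l , proj₁ (proj₂ scaling) , (begin
      ω * norm c ≈⟨ *-congʳ norm-γ ⟨
      norm γ * norm c ≈⟨ norm-γ* c ⟨
      norm (γ* c) ≈⟨ norm-cong (proj₂ (proj₂ scaling)) ⟩
      norm (l · φ c) ≈⟨ norm-· l (φ c) ⟩
      (l * l) * norm (φ c) ∎)
      where
      scaling = normalise-scale (γ* c) (γ*-nonzero (normalised-nonzero n))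
      l = proj₁ scaling

  SquareNorm NonSquareNorm : Pair → Set
  SquareNorm c = Normalised c × IsSquare (norm c)
  NonSquareNorm c = Normalised c × ¬ IsSquare (norm c)

  private
    φ-square : ∀ {c} → SquareNorm c → NonSquareNorm (φ c)
    φ-square {c} (n , □N) = normalised-normalise (γ* c) , λ □Nφ →
      nonSquare-*ˡ (norm-nonzero (normalised-nonzero n)) □N ¬□ω
        (isSquare-resp (trans (sym (proj₂ (proj₂ (ω*norm≈□*norm-φ n)))) (*-comm ω (norm c))) (isSquare-*ˡ □Nφ))

    φ-nonSquare : ∀ {c} → NonSquareNorm c → SquareNorm (φ c)
    φ-nonSquare {c} (n , ¬□N) = normalised-normalise (γ* c) ,
      isSquare-/ˡ (proj₁ (proj₂ (ω*norm≈□*norm-φ n))) (isSquare-resp (proj₂ (proj₂ (ω*norm≈□*norm-φ n))) (nonSquare-*-nonSquare ¬□ω ¬□N))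

    square? = Counting.partition Pairs (λ c → isSquare? (norm c)) (λ c≈c′ → isSquare-resp (norm-cong c≈c′)) hasCard-normalised
    module Square? = Counting.Partition square?

  opaque
    #half : ℕ
    #half = Square?.#in

    hasCard-squareNorm : HasCard SquareNorm #half
    hasCard-squareNorm = Square?.inside

    #squareNorm≡#nonSquareNorm : Square?.#in ≡ Square?.#out
    #squareNorm≡#nonSquareNorm = ℕP.≤-antisym
      (hasCard-≤ Pairs Pairs Square?.inside Square?.outside φ φ-square λ p p′ → φ-injective (proj₁ p) (proj₁ p′))
      (hasCard-≤ Pairs Pairs Square?.outside Square?.inside φ φ-nonSquare λ p p′ → φ-injective (proj₁ p) (proj₁ p′))

    hasCard-nonSquareNorm : HasCard NonSquareNorm #half
    hasCard-nonSquareNorm = ≡.subst (HasCard NonSquareNorm) (≡.sym #squareNorm≡#nonSquareNorm) Square?.outside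

    #half+#half≡1+order : #half ℕ.+ #half ≡ suc order
    #half+#half≡1+order = ≡.trans (≡.cong (#half ℕ.+_) #squareNorm≡#nonSquareNorm) Square?.#in+#out

module Space (F : FiniteField) (ω : FiniteField.Carrier F) where
  open FieldFacts F
  open PG3 F public
  open Quadric ω public
  open SetoidReasoning setoid

  X₁ X₂ X₃ X₄ : Fin 4
  X₁ = 0F
  X₂ = sucF 0F
  X₃ = sucF (sucF 0F)
  X₄ = sucF (sucF (sucF 0F))

  vec : Carrier → Carrier → Carrier → Carrier → V4
  vec a b c d 0F = a
  vec a b c d (sucF 0F) = b
  vec a b c d (sucF (sucF 0F)) = c
  vec a b c d (sucF (sucF (sucF 0F))) = d

  ≈ᵥ-refl : ∀ {x} → x ≈ᵥ x
  ≈ᵥ-refl i = refl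

  ≈ᵥ-sym : ∀ {x y} → x ≈ᵥ y → y ≈ᵥ x
  ≈ᵥ-sym x≈y i = sym (x≈y i)

  ≈ᵥ-trans : ∀ {x y z} → x ≈ᵥ y → y ≈ᵥ z → x ≈ᵥ z
  ≈ᵥ-trans x≈y y≈z i = trans (x≈y i) (y≈z i)

  lin-cong : ∀ {a a′ u u′ b b′ v v′} → a ≈ a′ → u ≈ᵥ u′ → b ≈ b′ → v ≈ᵥ v′ → lin a u b v ≈ᵥ lin a′ u′ b′ v′
  lin-cong a≈ u≈ b≈ v≈ i = +-cong (*-cong a≈ (u≈ i)) (*-cong b≈ (v≈ i))

  lin-zero : ∀ {x y} → lin 0# x 0# y ≈ᵥ 0ᵥ
  lin-zero i = trans (+-cong (zeroˡ _) (zeroˡ _)) (+-identityʳ 0#)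

  lin-lin : ∀ a a₁ b₁ b a₂ b₂ u v →
    lin a (lin a₁ u b₁ v) b (lin a₂ u b₂ v) ≈ᵥ lin (a * a₁ + b * a₂) u (a * b₁ + b * b₂) v
  lin-lin a a₁ b₁ b a₂ b₂ u v i = solve 8 (λ a a₁ b₁ b a₂ b₂ x y →
    a ⊗ (a₁ ⊗ x ⊕ b₁ ⊗ y) ⊕ b ⊗ (a₂ ⊗ x ⊕ b₂ ⊗ y) := (a ⊗ a₁ ⊕ b ⊗ a₂) ⊗ x ⊕ (a ⊗ b₁ ⊕ b ⊗ b₂) ⊗ y)
    refl a a₁ b₁ b a₂ b₂ (u i) (v i)

  Q-cong : ∀ {u v} → u ≈ᵥ v → Q u ≈ Q v
  Q-cong u≈v = +-cong (+-cong (*-cong (u≈v X₁) (u≈v X₁)) (-‿cong (*-congˡ (*-cong (u≈v X₂) (u≈v X₂)))))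
                      (*-cong (u≈v X₃) (u≈v X₄))

  polar : V4 → V4 → Carrier
  polar u v = ((u X₁ * v X₁ + u X₁ * v X₁) - (ω * (u X₂ * v X₂) + ω * (u X₂ * v X₂))) + (u X₃ * v X₄ + u X₄ * v X₃)

  polar-cong : ∀ {u u′ v v′} → u ≈ᵥ u′ → v ≈ᵥ v′ → polar u v ≈ polar u′ v′
  polar-cong u≈ v≈ = +-cong
    (+-cong (+-cong (*-cong (u≈ X₁) (v≈ X₁)) (*-cong (u≈ X₁) (v≈ X₁)))
      (-‿cong (+-cong (*-congˡ (*-cong (u≈ X₂) (v≈ X₂))) (*-congˡ (*-cong (u≈ X₂) (v≈ X₂))))))
    (+-cong (*-cong (u≈ X₃) (v≈ X₄)) (*-cong (u≈ X₄) (v≈ X₃)))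

  polar-comm : ∀ u v → polar u v ≈ polar v u
  polar-comm u v = solve 9 (λ u₁ u₂ u₃ u₄ v₁ v₂ v₃ v₄ w →
    ((u₁ ⊗ v₁ ⊕ u₁ ⊗ v₁) ⊕ (⊝ (w ⊗ (u₂ ⊗ v₂) ⊕ w ⊗ (u₂ ⊗ v₂)))) ⊕ (u₃ ⊗ v₄ ⊕ u₄ ⊗ v₃)
    := ((v₁ ⊗ u₁ ⊕ v₁ ⊗ u₁) ⊕ (⊝ (w ⊗ (v₂ ⊗ u₂) ⊕ w ⊗ (v₂ ⊗ u₂)))) ⊕ (v₃ ⊗ u₄ ⊕ v₄ ⊗ u₃))
    refl (u X₁) (u X₂) (u X₃) (u X₄) (v X₁) (v X₂) (v X₃) (v X₄) ω

  polar-linʳ : ∀ u a v b w → polar u (lin a v b w) ≈ a * polar u v + b * polar u w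
  polar-linʳ u a v b w = solve 15 (λ u₁ u₂ u₃ u₄ a v₁ v₂ v₃ v₄ b w₁ w₂ w₃ w₄ o →
    ((u₁ ⊗ (a ⊗ v₁ ⊕ b ⊗ w₁) ⊕ u₁ ⊗ (a ⊗ v₁ ⊕ b ⊗ w₁)) ⊕ (⊝ (o ⊗ (u₂ ⊗ (a ⊗ v₂ ⊕ b ⊗ w₂)) ⊕ o ⊗ (u₂ ⊗ (a ⊗ v₂ ⊕ b ⊗ w₂)))))
      ⊕ (u₃ ⊗ (a ⊗ v₄ ⊕ b ⊗ w₄) ⊕ u₄ ⊗ (a ⊗ v₃ ⊕ b ⊗ w₃))
    := a ⊗ (((u₁ ⊗ v₁ ⊕ u₁ ⊗ v₁) ⊕ (⊝ (o ⊗ (u₂ ⊗ v₂) ⊕ o ⊗ (u₂ ⊗ v₂)))) ⊕ (u₃ ⊗ v₄ ⊕ u₄ ⊗ v₃))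
       ⊕ b ⊗ (((u₁ ⊗ w₁ ⊕ u₁ ⊗ w₁) ⊕ (⊝ (o ⊗ (u₂ ⊗ w₂) ⊕ o ⊗ (u₂ ⊗ w₂)))) ⊕ (u₃ ⊗ w₄ ⊕ u₄ ⊗ w₃)))
    refl (u X₁) (u X₂) (u X₃) (u X₄) a (v X₁) (v X₂) (v X₃) (v X₄) b (w X₁) (w X₂) (w X₃) (w X₄) ω

  polar-scale-self : ∀ a b x → polar (scale a x) (scale b x) ≈ ((1# + 1#) * (a * b)) * Q x
  polar-scale-self a b x = solve 7 (λ a b x₁ x₂ x₃ x₄ w →
    (((a ⊗ x₁) ⊗ (b ⊗ x₁) ⊕ (a ⊗ x₁) ⊗ (b ⊗ x₁)) ⊕ (⊝ (w ⊗ ((a ⊗ x₂) ⊗ (b ⊗ x₂)) ⊕ w ⊗ ((a ⊗ x₂) ⊗ (b ⊗ x₂)))))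
      ⊕ ((a ⊗ x₃) ⊗ (b ⊗ x₄) ⊕ (a ⊗ x₄) ⊗ (b ⊗ x₃))
    := ((𝟙 ⊕ 𝟙) ⊗ (a ⊗ b)) ⊗ ((x₁ ⊗ x₁ ⊕ (⊝ (w ⊗ (x₂ ⊗ x₂)))) ⊕ x₃ ⊗ x₄))
    refl a b (x X₁) (x X₂) (x X₃) (x X₄) ω

  Q-lin : ∀ a u b v → Q (lin a u b v) ≈ ((a * a) * Q u + (a * b) * polar u v) + (b * b) * Q v
  Q-lin a u b v = solve 11 (λ a b u₁ u₂ u₃ u₄ v₁ v₂ v₃ v₄ w →
    ((a ⊗ u₁ ⊕ b ⊗ v₁) ⊗ (a ⊗ u₁ ⊕ b ⊗ v₁) ⊕ (⊝ (w ⊗ ((a ⊗ u₂ ⊕ b ⊗ v₂) ⊗ (a ⊗ u₂ ⊕ b ⊗ v₂))))) ⊕ ((a ⊗ u₃ ⊕ b ⊗ v₃) ⊗ (a ⊗ u₄ ⊕ b ⊗ v₄))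
    := ((a ⊗ a) ⊗ ((u₁ ⊗ u₁ ⊕ (⊝ (w ⊗ (u₂ ⊗ u₂)))) ⊕ u₃ ⊗ u₄)
         ⊕ (a ⊗ b) ⊗ (((u₁ ⊗ v₁ ⊕ u₁ ⊗ v₁) ⊕ (⊝ (w ⊗ (u₂ ⊗ v₂) ⊕ w ⊗ (u₂ ⊗ v₂)))) ⊕ (u₃ ⊗ v₄ ⊕ u₄ ⊗ v₃)))
       ⊕ (b ⊗ b) ⊗ ((v₁ ⊗ v₁ ⊕ (⊝ (w ⊗ (v₂ ⊗ v₂)))) ⊕ v₃ ⊗ v₄))
    refl a b (u X₁) (u X₂) (u X₃) (u X₄) (v X₁) (v X₂) (v X₃) (v X₄) ω

  OnLine-resp : ∀ L {x y} → x ≈ᵥ y → OnLine x L → OnLine y L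
  OnLine-resp L x≈y (a , b , x≈) = a , b , ≈ᵥ-trans (≈ᵥ-sym x≈y) x≈

  OnLine-lin : ∀ L {x y} a b → OnLine x L → OnLine y L → OnLine (lin a x b y) L
  OnLine-lin L a b (a₁ , b₁ , x≈) (a₂ , b₂ , y≈) =
    a * a₁ + b * a₂ , a * b₁ + b * b₂ , ≈ᵥ-trans (lin-cong refl x≈ refl y≈) (lin-lin a a₁ b₁ b a₂ b₂ (Line.u L) (Line.v L))

  OnLine-scale : ∀ L {x} c → OnLine x L → OnLine (scale c x) L
  OnLine-scale L c x∈L = OnLine-resp L (λ i → trans (+-congˡ (zeroˡ _)) (+-identityʳ _)) (OnLine-lin L c 0# x∈L x∈L)

  OnLine-unscale : ∀ L {x y c} → ¬ c ≈ 0# → x ≈ᵥ scale c y → OnLine x L → OnLine y L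
  OnLine-unscale L {x} {y} {c} c≉0 x≈cy x∈L = OnLine-resp L (λ i → begin
    inv c c≉0 * x i ≈⟨ *-congˡ (x≈cy i) ⟩
    inv c c≉0 * (c * y i) ≈⟨ *-assoc _ _ _ ⟨
    (inv c c≉0 * c) * y i ≈⟨ trans (*-congʳ (*-inverseˡ c c≉0)) (*-identityˡ _) ⟩
    y i ∎) (OnLine-scale L (inv c c≉0) x∈L)

  OnLine-u : ∀ L → OnLine (Line.u L) L
  OnLine-u L = 1# , 0# , λ i → trans (sym (+-identityʳ _)) (+-cong (sym (*-identityˡ _)) (sym (zeroˡ _)))

  OnLine-v : ∀ L → OnLine (Line.v L) L
  OnLine-v L = 0# , 1# , λ i → trans (sym (+-identityˡ _)) (+-cong (sym (zeroˡ _)) (sym (*-identityˡ _)))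

  OnLine-span : ∀ L M {x} → OnLine (Line.u M) L → OnLine (Line.v M) L → OnLine x M → OnLine x L
  OnLine-span L M u∈L v∈L (a , b , x≈) = OnLine-resp L (≈ᵥ-sym x≈) (OnLine-lin L a b u∈L v∈L)

  ≈L-refl : ∀ {L} → L ≈L L
  ≈L-refl {L} = (OnLine-u L , OnLine-v L) , (OnLine-u L , OnLine-v L)

  ≈L-sym : ∀ {L M} → L ≈L M → M ≈L L
  ≈L-sym (L⊇M , M⊇L) = M⊇L , L⊇M

  ≈L-trans : ∀ {L M N} → L ≈L M → M ≈L N → L ≈L N
  ≈L-trans {L} {M} {N} ((Mu∈L , Mv∈L) , (Lu∈M , Lv∈M)) ((Nu∈M , Nv∈M) , (Mu∈N , Mv∈N)) =
    (OnLine-span L M Mu∈L Mv∈L Nu∈M , OnLine-span L M Mu∈L Mv∈L Nv∈M) ,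
    (OnLine-span N M Mu∈N Mv∈N Lu∈M , OnLine-span N M Mu∈N Mv∈N Lv∈M)

  OnLine-≈L : ∀ {L M x} → L ≈L M → OnLine x L → OnLine x M
  OnLine-≈L {L} {M} (_ , (Lu∈M , Lv∈M)) = OnLine-span M L Lu∈M Lv∈M

  Lines : Setoid 0ℓ 0ℓ
  Lines = record
    { Carrier = Line
    ; _≈_ = _≈L_
    ; isEquivalence = record
      { refl = λ {L} → ≈L-refl {L}
      ; sym = λ {L} {M} → ≈L-sym {L} {M}
      ; trans = λ {L} {M} {N} → ≈L-trans {L} {M} {N}
      }
    }

  -- InL0 = InClass IsSquare and InL1 = InClass (¬_ ∘ IsSquare), definitionally.
  InClass : (Carrier → Set) → Line → Set
  InClass C L = Tangent L × (∀ r → NonZero r → OnLine r L → ¬ OnE r → C (Q r))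

  tangent-resp : ∀ {L M} → L ≈L M → Tangent L → Tangent M
  tangent-resp {L} {M} L≈M (p , p≉0 , p∈L , p∈E , unique) =
    p , p≉0 , OnLine-≈L {L} {M} L≈M p∈L , p∈E ,
    λ r r≉0 r∈M r∈E → unique r r≉0 (OnLine-≈L {M} {L} (≈L-sym {L} {M} L≈M) r∈M) r∈E

  inClass-resp : ∀ C {L M} → L ≈L M → InClass C L → InClass C M
  inClass-resp C {L} {M} L≈M (tangent , class) =
    tangent-resp {L} {M} L≈M tangent ,
    λ r r≉0 r∈M r∉E → class r r≉0 (OnLine-≈L {M} {L} (≈L-sym {L} {M} L≈M) r∈M) r∉E

  meet-resp : ∀ {L L′ M M′} → L ≈L L′ → M ≈L M′ → MeetInOnePoint L M → MeetInOnePoint L′ M′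
  meet-resp {L} {L′} {M} {M′} L≈L′ M≈M′ (p , p≉0 , p∈L , p∈M , unique) =
    p , p≉0 , OnLine-≈L {L} {L′} L≈L′ p∈L , OnLine-≈L {M} {M′} M≈M′ p∈M ,
    λ r r≉0 r∈L′ r∈M′ → unique r r≉0 (OnLine-≈L {L′} {L} (≈L-sym {L} {L′} L≈L′) r∈L′)
                                        (OnLine-≈L {M′} {M} (≈L-sym {M} {M′} M≈M′) r∈M′)

  record Isometry : Set where
    field
      to from : V4 → V4
      to-cong : ∀ {x y} → x ≈ᵥ y → to x ≈ᵥ to y
      from-cong : ∀ {x y} → x ≈ᵥ y → from x ≈ᵥ from y
      to-lin : ∀ a x b y → to (lin a x b y) ≈ᵥ lin a (to x) b (to y)
      from-lin : ∀ a x b y → from (lin a x b y) ≈ᵥ lin a (from x) b (from y)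
      Q-to : ∀ x → Q (to x) ≈ Q x
      Q-from : ∀ x → Q (from x) ≈ Q x
      from-to : ∀ x → from (to x) ≈ᵥ x
      to-from : ∀ x → to (from x) ≈ᵥ x

  invert : Isometry → Isometry
  invert I = record
    { to = from ; from = to ; to-cong = from-cong ; from-cong = to-cong ; to-lin = from-lin ; from-lin = to-lin
    ; Q-to = Q-from ; Q-from = Q-to ; from-to = to-from ; to-from = from-to }
    where open Isometry I

  module Image (I : Isometry) where
    open Isometry I

    private
      scale≈lin : ∀ c x → scale c x ≈ᵥ lin c x 0# x
      scale≈lin c x i = trans (sym (+-identityʳ _)) (+-congˡ (sym (zeroˡ _)))

      from-zero : from 0ᵥ ≈ᵥ 0ᵥ
      from-zero = ≈ᵥ-trans (from-cong (≈ᵥ-sym lin-zero)) (≈ᵥ-trans (from-lin 0# 0ᵥ 0# 0ᵥ) lin-zero)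

    image : Line → Line
    image L = mkLine (to (Line.u L)) (to (Line.v L)) λ a b ab≈0 → Line.indep L a b
      (≈ᵥ-trans (≈ᵥ-sym (from-to _)) (≈ᵥ-trans (from-cong (≈ᵥ-trans (to-lin a (Line.u L) b (Line.v L)) ab≈0)) from-zero))

    OnLine-image : ∀ {x} L → OnLine x L → OnLine (to x) (image L)
    OnLine-image L (a , b , x≈) = a , b , ≈ᵥ-trans (to-cong x≈) (to-lin a (Line.u L) b (Line.v L))

    OnLine-preimage : ∀ {y} L → OnLine y (image L) → OnLine (from y) L
    OnLine-preimage L (a , b , y≈) = a , b , ≈ᵥ-trans (from-cong y≈)
      (≈ᵥ-trans (from-lin a _ b _) (lin-cong refl (from-to (Line.u L)) refl (from-to (Line.v L))))

    nonZero-to : ∀ {x} → NonZero x → NonZero (to x)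
    nonZero-to {x} x≉0 tx≈0 = x≉0 (≈ᵥ-trans (≈ᵥ-sym (from-to x)) (≈ᵥ-trans (from-cong tx≈0) from-zero))

    nonZero-from : ∀ {y} → NonZero y → NonZero (from y)
    nonZero-from {y} y≉0 fy≈0 = y≉0 (≈ᵥ-trans (≈ᵥ-sym (to-from y)) (≈ᵥ-trans (to-cong fy≈0)
      (≈ᵥ-trans (to-cong (≈ᵥ-sym lin-zero)) (≈ᵥ-trans (to-lin 0# 0ᵥ 0# 0ᵥ) lin-zero))))

    samePoint-to : ∀ {x y} → SamePoint x y → SamePoint (to x) (to y)
    samePoint-to {y = y} (c , x≈cy) = c , ≈ᵥ-trans (to-cong (≈ᵥ-trans x≈cy (scale≈lin c y)))
      (≈ᵥ-trans (to-lin c y 0# y) (≈ᵥ-sym (scale≈lin c (to y))))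

    samePoint-to-from : ∀ {y p} → SamePoint (from y) p → SamePoint y (to p)
    samePoint-to-from {y} sp with samePoint-to sp
    ... | c , tfy≈ = c , ≈ᵥ-trans (≈ᵥ-sym (to-from y)) tfy≈

    ≈L-image : ∀ {L M} → L ≈L M → image L ≈L image M
    ≈L-image {L} {M} ((Mu∈L , Mv∈L) , (Lu∈M , Lv∈M)) =
      (OnLine-image L Mu∈L , OnLine-image L Mv∈L) , (OnLine-image M Lu∈M , OnLine-image M Lv∈M)

    tangent-image : ∀ L → Tangent L → Tangent (image L)
    tangent-image L (p , p≉0 , p∈L , p∈E , unique) = to p , nonZero-to p≉0 , OnLine-image L p∈L , trans (Q-to p) p∈E ,
      λ r r≉0 r∈L′ r∈E → samePoint-to-from (unique (from r) (nonZero-from r≉0) (OnLine-preimage L r∈L′) (trans (Q-from r) r∈E))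

    inClass-image : ∀ C → (∀ {a b} → a ≈ b → C a → C b) → ∀ L → InClass C L → InClass C (image L)
    inClass-image C C-resp L (tangent , class) = tangent-image L tangent , λ r r≉0 r∈L′ r∉E →
      C-resp (Q-from r) (class (from r) (nonZero-from r≉0) (OnLine-preimage L r∈L′) (λ fr∈E → r∉E (trans (sym (Q-from r)) fr∈E)))

    meet-image : ∀ L M → MeetInOnePoint L M → MeetInOnePoint (image L) (image M)
    meet-image L M (p , p≉0 , p∈L , p∈M , unique) = to p , nonZero-to p≉0 , OnLine-image L p∈L , OnLine-image M p∈M ,
      λ r r≉0 r∈L′ r∈M′ → samePoint-to-from (unique (from r) (nonZero-from r≉0) (OnLine-preimage L r∈L′) (OnLine-preimage M r∈M′))

  open Image public

  image-invert : ∀ I L → image (invert I) (image I L) ≈L L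
  image-invert I L =
    (OnLine-resp L′ (Isometry.from-to I (Line.u L)) (OnLine-u L′) , OnLine-resp L′ (Isometry.from-to I (Line.v L)) (OnLine-v L′)) ,
    (OnLine-resp L (≈ᵥ-sym (Isometry.from-to I (Line.u L))) (OnLine-u L) , OnLine-resp L (≈ᵥ-sym (Isometry.from-to I (Line.v L))) (OnLine-v L))
    where L′ = image (invert I) (image I L)

  hasSize-image⁻¹ : ∀ C → (∀ {a b} → a ≈ b → C a → C b) → (I : Isometry) → ∀ ℓ n →
    HasSize (λ m → InClass C m × MeetInOnePoint m (image I ℓ)) n → HasSize (λ m → InClass C m × MeetInOnePoint m ℓ) n
  hasSize-image⁻¹ C C-resp I ℓ n count = hasCard-transport Lines Lines count (image J)
    (λ {m} (inC , meets) → inClass-image J C C-resp m inC ,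
      meet-resp {image J m} {image J m} {image J (image I ℓ)} {ℓ} (≈L-refl {image J m}) (image-invert I ℓ) (meet-image J m (image I ℓ) meets))
    (λ {m} {m′} _ _ Jm≈Jm′ → ≈L-trans {m} {image I (image J m)} {m′} (≈L-sym {image I (image J m)} {m} (image-invert J m))
      (≈L-trans {image I (image J m)} {image I (image J m′)} {m′} (≈L-image I {image J m} {image J m′} Jm≈Jm′) (image-invert J m′)))
    (λ {m} (inC , meets) → image I m , (inClass-image I C C-resp m inC , meet-image I m ℓ meets) , ≈L-sym {image J (image I m)} {m} (image-invert I m))
    (λ {m} {m′} → ≈L-image J {m} {m′})
    where J = invert I

module Isometries (F : FiniteField) (ω : FiniteField.Carrier F) where
  open FieldFacts F
  open Space F ω

  swap₃₄ : Isometry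
  swap₃₄ = record
    { to = swap ; from = swap ; to-cong = swap-cong ; from-cong = swap-cong ; to-lin = swap-lin ; from-lin = swap-lin
    ; Q-to = Q-swap ; Q-from = Q-swap ; from-to = swap-swap ; to-from = swap-swap }
    where
    swap : V4 → V4
    swap x = vec (x X₁) (x X₂) (x X₄) (x X₃)
    swap-cong : ∀ {x y} → x ≈ᵥ y → swap x ≈ᵥ swap y
    swap-cong x≈y 0F = x≈y X₁
    swap-cong x≈y (sucF 0F) = x≈y X₂
    swap-cong x≈y (sucF (sucF 0F)) = x≈y X₄
    swap-cong x≈y (sucF (sucF (sucF 0F))) = x≈y X₃
    swap-lin : ∀ a x b y → swap (lin a x b y) ≈ᵥ lin a (swap x) b (swap y)
    swap-lin a x b y 0F = refl
    swap-lin a x b y (sucF 0F) = refl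
    swap-lin a x b y (sucF (sucF 0F)) = refl
    swap-lin a x b y (sucF (sucF (sucF 0F))) = refl
    Q-swap : ∀ x → Q (swap x) ≈ Q x
    Q-swap x = +-congˡ (*-comm _ _)
    swap-swap : ∀ x → swap (swap x) ≈ᵥ x
    swap-swap x 0F = refl
    swap-swap x (sucF 0F) = refl
    swap-swap x (sucF (sucF 0F)) = refl
    swap-swap x (sucF (sucF (sucF 0F))) = refl

  -- An Eichler transformation; it sends the point (−y₁, −y₂, −y₁² + ω y₂², 1) of E to (0, 0, 0, 1).
  shear : Carrier → Carrier → V4 → V4
  shear y₁ y₂ x = vec (x X₁ + x X₄ * y₁) (x X₂ + x X₄ * y₂)
    (x X₃ - (((x X₁ * y₁ + x X₁ * y₁) - (ω * (x X₂ * y₂) + ω * (x X₂ * y₂))) + x X₄ * (y₁ * y₁ - ω * (y₂ * y₂)))) (x X₄)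

  shear-cong : ∀ y₁ y₂ {x z} → x ≈ᵥ z → shear y₁ y₂ x ≈ᵥ shear y₁ y₂ z
  shear-cong y₁ y₂ x≈z 0F = +-cong (x≈z X₁) (*-congʳ (x≈z X₄))
  shear-cong y₁ y₂ x≈z (sucF 0F) = +-cong (x≈z X₂) (*-congʳ (x≈z X₄))
  shear-cong y₁ y₂ x≈z (sucF (sucF 0F)) = +-cong (x≈z X₃) (-‿cong (+-cong (+-cong (+-cong (*-congʳ (x≈z X₁)) (*-congʳ (x≈z X₁)))
    (-‿cong (+-cong (*-congˡ (*-congʳ (x≈z X₂))) (*-congˡ (*-congʳ (x≈z X₂)))))) (*-congʳ (x≈z X₄))))
  shear-cong y₁ y₂ x≈z (sucF (sucF (sucF 0F))) = x≈z X₄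

  shear-lin : ∀ y₁ y₂ a x b z → shear y₁ y₂ (lin a x b z) ≈ᵥ lin a (shear y₁ y₂ x) b (shear y₁ y₂ z)
  shear-lin y₁ y₂ a x b z 0F = solve 7 (λ a b x₁ x₄ z₁ z₄ y →
    (a ⊗ x₁ ⊕ b ⊗ z₁) ⊕ (a ⊗ x₄ ⊕ b ⊗ z₄) ⊗ y := a ⊗ (x₁ ⊕ x₄ ⊗ y) ⊕ b ⊗ (z₁ ⊕ z₄ ⊗ y)) refl a b (x X₁) (x X₄) (z X₁) (z X₄) y₁
  shear-lin y₁ y₂ a x b z (sucF 0F) = solve 7 (λ a b x₂ x₄ z₂ z₄ y →
    (a ⊗ x₂ ⊕ b ⊗ z₂) ⊕ (a ⊗ x₄ ⊕ b ⊗ z₄) ⊗ y := a ⊗ (x₂ ⊕ x₄ ⊗ y) ⊕ b ⊗ (z₂ ⊕ z₄ ⊗ y)) refl a b (x X₂) (x X₄) (z X₂) (z X₄) y₂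
  shear-lin y₁ y₂ a x b z (sucF (sucF 0F)) = solve 13 (λ a b x₁ x₂ x₃ x₄ z₁ z₂ z₃ z₄ y₁ y₂ w →
    let sh : _ → _ → _ → _ → _
        sh x₁ x₂ x₃ x₄ = x₃ ⊕ (⊝ ((((x₁ ⊗ y₁) ⊕ (x₁ ⊗ y₁)) ⊕ (⊝ ((w ⊗ (x₂ ⊗ y₂)) ⊕ (w ⊗ (x₂ ⊗ y₂))))) ⊕ x₄ ⊗ (y₁ ⊗ y₁ ⊕ (⊝ (w ⊗ (y₂ ⊗ y₂))))))
    in sh (a ⊗ x₁ ⊕ b ⊗ z₁) (a ⊗ x₂ ⊕ b ⊗ z₂) (a ⊗ x₃ ⊕ b ⊗ z₃) (a ⊗ x₄ ⊕ b ⊗ z₄) := a ⊗ sh x₁ x₂ x₃ x₄ ⊕ b ⊗ sh z₁ z₂ z₃ z₄)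
    refl a b (x X₁) (x X₂) (x X₃) (x X₄) (z X₁) (z X₂) (z X₃) (z X₄) y₁ y₂ ω
  shear-lin y₁ y₂ a x b z (sucF (sucF (sucF 0F))) = refl

  Q-shear : ∀ y₁ y₂ x → Q (shear y₁ y₂ x) ≈ Q x
  Q-shear y₁ y₂ x = solve 7 (λ x₁ x₂ x₃ x₄ y₁ y₂ w →
    ((x₁ ⊕ x₄ ⊗ y₁) ⊗ (x₁ ⊕ x₄ ⊗ y₁) ⊕ (⊝ (w ⊗ ((x₂ ⊕ x₄ ⊗ y₂) ⊗ (x₂ ⊕ x₄ ⊗ y₂)))))
      ⊕ (x₃ ⊕ (⊝ ((((x₁ ⊗ y₁) ⊕ (x₁ ⊗ y₁)) ⊕ (⊝ ((w ⊗ (x₂ ⊗ y₂)) ⊕ (w ⊗ (x₂ ⊗ y₂))))) ⊕ x₄ ⊗ (y₁ ⊗ y₁ ⊕ (⊝ (w ⊗ (y₂ ⊗ y₂))))))) ⊗ x₄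
    := (x₁ ⊗ x₁ ⊕ (⊝ (w ⊗ (x₂ ⊗ x₂)))) ⊕ x₃ ⊗ x₄)
    refl (x X₁) (x X₂) (x X₃) (x X₄) y₁ y₂ ω

  shear-shear : ∀ y₁ y₂ x → shear (- y₁) (- y₂) (shear y₁ y₂ x) ≈ᵥ x
  shear-shear y₁ y₂ x 0F = solve 3 (λ x₁ x₄ y → (x₁ ⊕ x₄ ⊗ y) ⊕ x₄ ⊗ (⊝ y) := x₁) refl (x X₁) (x X₄) y₁
  shear-shear y₁ y₂ x (sucF 0F) = solve 3 (λ x₂ x₄ y → (x₂ ⊕ x₄ ⊗ y) ⊕ x₄ ⊗ (⊝ y) := x₂) refl (x X₂) (x X₄) y₂
  shear-shear y₁ y₂ x (sucF (sucF 0F)) = solve 7 (λ x₁ x₂ x₃ x₄ y₁ y₂ w →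
    let sh : _ → _ → _ → _ → _ → _ → _
        sh y₁ y₂ x₁ x₂ x₃ x₄ = x₃ ⊕ (⊝ ((((x₁ ⊗ y₁) ⊕ (x₁ ⊗ y₁)) ⊕ (⊝ ((w ⊗ (x₂ ⊗ y₂)) ⊕ (w ⊗ (x₂ ⊗ y₂))))) ⊕ x₄ ⊗ (y₁ ⊗ y₁ ⊕ (⊝ (w ⊗ (y₂ ⊗ y₂))))))
    in sh (⊝ y₁) (⊝ y₂) (x₁ ⊕ x₄ ⊗ y₁) (x₂ ⊕ x₄ ⊗ y₂) (sh y₁ y₂ x₁ x₂ x₃ x₄) x₄ := x₃)
    refl (x X₁) (x X₂) (x X₃) (x X₄) y₁ y₂ ω
  shear-shear y₁ y₂ x (sucF (sucF (sucF 0F))) = refl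

  shear⁻-shear : ∀ y₁ y₂ x → shear y₁ y₂ (shear (- y₁) (- y₂) x) ≈ᵥ x
  shear⁻-shear y₁ y₂ x 0F = solve 3 (λ x₁ x₄ y → (x₁ ⊕ x₄ ⊗ (⊝ y)) ⊕ x₄ ⊗ y := x₁) refl (x X₁) (x X₄) y₁
  shear⁻-shear y₁ y₂ x (sucF 0F) = solve 3 (λ x₂ x₄ y → (x₂ ⊕ x₄ ⊗ (⊝ y)) ⊕ x₄ ⊗ y := x₂) refl (x X₂) (x X₄) y₂
  shear⁻-shear y₁ y₂ x (sucF (sucF 0F)) = solve 7 (λ x₁ x₂ x₃ x₄ y₁ y₂ w →
    let sh : _ → _ → _ → _ → _ → _ → _
        sh y₁ y₂ x₁ x₂ x₃ x₄ = x₃ ⊕ (⊝ ((((x₁ ⊗ y₁) ⊕ (x₁ ⊗ y₁)) ⊕ (⊝ ((w ⊗ (x₂ ⊗ y₂)) ⊕ (w ⊗ (x₂ ⊗ y₂))))) ⊕ x₄ ⊗ (y₁ ⊗ y₁ ⊕ (⊝ (w ⊗ (y₂ ⊗ y₂))))))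
    in sh y₁ y₂ (x₁ ⊕ x₄ ⊗ (⊝ y₁)) (x₂ ⊕ x₄ ⊗ (⊝ y₂)) (sh (⊝ y₁) (⊝ y₂) x₁ x₂ x₃ x₄) x₄ := x₃)
    refl (x X₁) (x X₂) (x X₃) (x X₄) y₁ y₂ ω
  shear⁻-shear y₁ y₂ x (sucF (sucF (sucF 0F))) = refl

  shearing : Carrier → Carrier → Isometry
  shearing y₁ y₂ = record
    { to = shear y₁ y₂ ; from = shear (- y₁) (- y₂) ; to-cong = shear-cong y₁ y₂ ; from-cong = shear-cong (- y₁) (- y₂)
    ; to-lin = shear-lin y₁ y₂ ; from-lin = shear-lin (- y₁) (- y₂) ; Q-to = Q-shear y₁ y₂ ; Q-from = Q-shear (- y₁) (- y₂)
    ; from-to = shear-shear y₁ y₂ ; to-from = shear⁻-shear y₁ y₂ }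

module Tangents (F : FiniteField) (ω : FiniteField.Carrier F) where
  open FieldFacts F
  open Space F ω
  open SetoidReasoning setoid

  Independent : V4 → V4 → Set
  Independent p q = ∀ a b → lin a p b q ≈ᵥ 0ᵥ → a ≈ 0# × b ≈ 0#

  u-nonZero : ∀ L → NonZero (Line.u L)
  u-nonZero L u≈0 = 1≉0 (proj₁ (Line.indep L 1# 0# λ i → trans (+-cong (*-congˡ (u≈0 i)) (zeroˡ _)) (trans (+-identityʳ _) (zeroʳ 1#))))

  -- Cramer's rule: solve p = a₁u + b₁v, q = a₂u + b₂v for u and v.
  ≈L-mkLine : ∀ L {p q} → OnLine p L → OnLine q L → (indep : Independent p q) → L ≈L mkLine p q indep
  ≈L-mkLine L {p} {q} p∈L@(a₁ , b₁ , p≈) q∈L@(a₂ , b₂ , q≈) indep =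
    (p∈L , q∈L) , (b₂ * D⁻¹ , - b₁ * D⁻¹ , λ i → u≈ i) , (- a₂ * D⁻¹ , a₁ * D⁻¹ , λ i → v≈ i)
    where
    u = Line.u L
    v = Line.v L
    D = a₁ * b₂ - a₂ * b₁
    Du≈ : lin b₂ p (- b₁) q ≈ᵥ scale D u
    Du≈ i = begin
      b₂ * p i + - b₁ * q i ≈⟨ +-cong (*-congˡ (p≈ i)) (*-congˡ (q≈ i)) ⟩
      b₂ * (a₁ * u i + b₁ * v i) + - b₁ * (a₂ * u i + b₂ * v i) ≈⟨ solve 6 (λ a₁ b₁ a₂ b₂ x y →
        b₂ ⊗ (a₁ ⊗ x ⊕ b₁ ⊗ y) ⊕ (⊝ b₁) ⊗ (a₂ ⊗ x ⊕ b₂ ⊗ y) := (a₁ ⊗ b₂ ⊕ (⊝ (a₂ ⊗ b₁))) ⊗ x) refl a₁ b₁ a₂ b₂ (u i) (v i) ⟩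
      D * u i ∎
    Dv≈ : lin (- a₂) p a₁ q ≈ᵥ scale D v
    Dv≈ i = begin
      - a₂ * p i + a₁ * q i ≈⟨ +-cong (*-congˡ (p≈ i)) (*-congˡ (q≈ i)) ⟩
      - a₂ * (a₁ * u i + b₁ * v i) + a₁ * (a₂ * u i + b₂ * v i) ≈⟨ solve 6 (λ a₁ b₁ a₂ b₂ x y →
        (⊝ a₂) ⊗ (a₁ ⊗ x ⊕ b₁ ⊗ y) ⊕ a₁ ⊗ (a₂ ⊗ x ⊕ b₂ ⊗ y) := (a₁ ⊗ b₂ ⊕ (⊝ (a₂ ⊗ b₁))) ⊗ y) refl a₁ b₁ a₂ b₂ (u i) (v i) ⟩
      D * v i ∎
    D≉0 : ¬ D ≈ 0#
    D≉0 D≈0 = u-nonZero (mkLine p q indep) λ i → begin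
      p i ≈⟨ p≈ i ⟩
      a₁ * u i + b₁ * v i ≈⟨ +-cong (*-congʳ a₁≈0) (*-congʳ b₁≈0) ⟩
      0# * u i + 0# * v i ≈⟨ lin-zero {u} {v} i ⟩
      0# ∎
      where
      a₁≈0 : a₁ ≈ 0#
      a₁≈0 = proj₂ (indep (- a₂) a₁ λ i → trans (Dv≈ i) (trans (*-congʳ D≈0) (zeroˡ _)))
      b₁≈0 : b₁ ≈ 0#
      b₁≈0 = trans (sym (-‿involutive b₁)) (trans (-‿cong (proj₂ (indep b₂ (- b₁) λ i → trans (Du≈ i) (trans (*-congʳ D≈0) (zeroˡ _))))) -0#≈0#)
    D⁻¹ = inv D D≉0
    solved : ∀ {a b x} → lin a p b q ≈ᵥ scale D x → ∀ i → x i ≈ (a * D⁻¹) * p i + (b * D⁻¹) * q i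
    solved {a} {b} {x} ≈Dx i = sym (begin
      (a * D⁻¹) * p i + (b * D⁻¹) * q i ≈⟨ solve 5 (λ a b d x y → (a ⊗ d) ⊗ x ⊕ (b ⊗ d) ⊗ y := d ⊗ (a ⊗ x ⊕ b ⊗ y)) refl a b D⁻¹ (p i) (q i) ⟩
      D⁻¹ * (a * p i + b * q i) ≈⟨ *-congˡ (≈Dx i) ⟩
      D⁻¹ * (D * x i) ≈⟨ *-assoc _ _ _ ⟨
      (D⁻¹ * D) * x i ≈⟨ trans (*-congʳ (*-inverseˡ D D≉0)) (*-identityˡ _) ⟩
      x i ∎)
    u≈ = solved {x = u} Du≈
    v≈ = solved {x = v} Dv≈

  second-point : ∀ L {p} → OnLine p L → NonZero p → ∃ λ w → OnLine w L × Independent p w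
  second-point L {p} (a , b , p≈) p≉0 with a ≟ 0#
  ... | no a≉0 = v , OnLine-v L , λ x y xp+yv≈0 →
    let a′≈0 , b′≈0 = Line.indep L (x * a) (x * b + y) λ i → trans (sym (expand i)) (xp+yv≈0 i)
        x≈0 = *-cancelˡ-zero a≉0 (trans (*-comm a x) a′≈0)
    in x≈0 , trans (sym (trans (+-congʳ (trans (*-congʳ x≈0) (zeroˡ b))) (+-identityˡ y))) b′≈0
    where
    u = Line.u L
    v = Line.v L
    expand : ∀ {x y} i → x * p i + y * v i ≈ (x * a) * u i + (x * b + y) * v i
    expand {x} {y} i = trans (+-congʳ (*-congˡ (p≈ i)))
      (solve 6 (λ x y a b u v → x ⊗ (a ⊗ u ⊕ b ⊗ v) ⊕ y ⊗ v := (x ⊗ a) ⊗ u ⊕ (x ⊗ b ⊕ y) ⊗ v) refl x y a b (u i) (v i))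
  ... | yes a≈0 = u , OnLine-u L , λ x y xp+yu≈0 →
    let y≈0 , b′≈0 = Line.indep L y (x * b) λ i → trans (sym (expand i)) (xp+yu≈0 i)
    in *-cancelˡ-zero b≉0 (trans (*-comm b x) b′≈0) , y≈0
    where
    u = Line.u L
    v = Line.v L
    b≉0 : ¬ b ≈ 0#
    b≉0 b≈0 = p≉0 λ i → trans (p≈ i) (trans (+-cong (*-congʳ a≈0) (*-congʳ b≈0)) (lin-zero {u} {v} i))
    expand : ∀ {x y} i → x * p i + y * u i ≈ y * u i + (x * b) * v i
    expand {x} {y} i = trans (+-congʳ (*-congˡ (trans (p≈ i) (+-congʳ (*-congʳ a≈0)))))
      (solve 5 (λ x y b u v → x ⊗ (𝟘 ⊗ u ⊕ b ⊗ v) ⊕ y ⊗ u := y ⊗ u ⊕ (x ⊗ b) ⊗ v) refl x y b (u i) (v i))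

  polar-self : ∀ x → polar x x ≈ (1# + 1#) * Q x
  polar-self x = solve 5 (λ x₁ x₂ x₃ x₄ w →
    ((x₁ ⊗ x₁ ⊕ x₁ ⊗ x₁) ⊕ (⊝ (w ⊗ (x₂ ⊗ x₂) ⊕ w ⊗ (x₂ ⊗ x₂)))) ⊕ (x₃ ⊗ x₄ ⊕ x₄ ⊗ x₃)
    := (𝟙 ⊕ 𝟙) ⊗ ((x₁ ⊗ x₁ ⊕ (⊝ (w ⊗ (x₂ ⊗ x₂)))) ⊕ x₃ ⊗ x₄)) refl (x X₁) (x X₂) (x X₃) (x X₄) ω

  -- If B(T, w) ≠ 0, then w − (Q(w)/B(T, w)) T is a second point of E on the line, one not equal to T.
  tangent⇒polar≈0 : ∀ L {T w} → Tangent L → NonZero T → OnLine T L → OnE T → OnLine w L → polar T w ≈ 0#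
  tangent⇒polar≈0 L {T} {w} (P , _ , _ , P∈E , unique) T≉0 T∈L T∈E w∈L = ≈-stable λ b≉0 →
    let t = - (Q w * inv (polar T w) b≉0)
        y = lin 1# w t T
        polar-Ty : polar T y ≈ polar T w
        polar-Ty = begin
          polar T y ≈⟨ polar-linʳ T 1# w t T ⟩
          1# * polar T w + t * polar T T ≈⟨ +-cong (*-identityˡ _) (*-congˡ (trans (polar-self T) (trans (*-congˡ T∈E) (zeroʳ _)))) ⟩
          polar T w + t * 0# ≈⟨ trans (+-congˡ (zeroʳ t)) (+-identityʳ _) ⟩
          polar T w ∎
        Qy≈0 : Q y ≈ 0#
        Qy≈0 = begin
          Q y ≈⟨ Q-lin 1# w t T ⟩
          ((1# * 1#) * Q w + (1# * t) * polar w T) + (t * t) * Q T ≈⟨ +-cong (+-congˡ (*-congˡ (polar-comm w T))) (*-congˡ T∈E) ⟩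
          ((1# * 1#) * Q w + (1# * t) * polar T w) + (t * t) * 0# ≈⟨ solve 4 (λ q b i s → ((𝟙 ⊗ 𝟙) ⊗ q ⊕ (𝟙 ⊗ (⊝ (q ⊗ i))) ⊗ b) ⊕ s ⊗ 𝟘
                                                                          := q ⊗ (𝟙 ⊕ (⊝ (b ⊗ i)))) refl (Q w) (polar T w) (inv (polar T w) b≉0) (t * t) ⟩
          Q w * (1# - polar T w * inv (polar T w) b≉0) ≈⟨ *-congˡ (+-congˡ (-‿cong (*-inverseʳ (polar T w) b≉0))) ⟩
          Q w * (1# - 1#) ≈⟨ trans (*-congˡ (-‿inverseʳ 1#)) (zeroʳ _) ⟩
          0# ∎
        y≉0 : NonZero y
        y≉0 y≈0 = b≉0 (trans (sym polar-Ty) (trans (polar-cong {T} {T} ≈ᵥ-refl y≈0)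
          (solve 5 (λ t₁ t₂ t₃ t₄ w → ((t₁ ⊗ 𝟘 ⊕ t₁ ⊗ 𝟘) ⊕ (⊝ (w ⊗ (t₂ ⊗ 𝟘) ⊕ w ⊗ (t₂ ⊗ 𝟘)))) ⊕ (t₃ ⊗ 𝟘 ⊕ t₄ ⊗ 𝟘) := 𝟘)
            refl (T X₁) (T X₂) (T X₃) (T X₄) ω)))
        c , y≈cP = unique y y≉0 (OnLine-lin L 1# t w∈L T∈L) Qy≈0
        c′ , T≈c′P = unique T T≉0 T∈L T∈E
    in b≉0 (begin
      polar T w ≈⟨ polar-Ty ⟨
      polar T y ≈⟨ polar-cong T≈c′P y≈cP ⟩
      polar (scale c′ P) (scale c P) ≈⟨ polar-scale-self c′ c P ⟩
      ((1# + 1#) * (c′ * c)) * Q P ≈⟨ trans (*-congˡ P∈E) (zeroʳ _) ⟩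
      0# ∎)

  module TangentLine (L : Line) (Qu≈0 : Q (Line.u L) ≈ 0#) (polar≈0 : polar (Line.u L) (Line.v L) ≈ 0#)
                     (Qv≉0 : ¬ Q (Line.v L) ≈ 0#) where
    private
      u = Line.u L
      v = Line.v L

      Q-on : ∀ {r} → OnLine r L → ∃₂ λ a b → r ≈ᵥ lin a u b v × Q r ≈ (b * b) * Q v
      Q-on {r} (a , b , r≈) = a , b , r≈ , (begin
        Q r ≈⟨ Q-cong r≈ ⟩
        Q (lin a u b v) ≈⟨ Q-lin a u b v ⟩
        ((a * a) * Q u + (a * b) * polar u v) + (b * b) * Q v ≈⟨ +-congʳ (+-cong (*-congˡ Qu≈0) (*-congˡ polar≈0)) ⟩
        ((a * a) * 0# + (a * b) * 0#) + (b * b) * Q v ≈⟨ +-congʳ (trans (+-cong (zeroʳ _) (zeroʳ _)) (+-identityʳ 0#)) ⟩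
        0# + (b * b) * Q v ≈⟨ +-identityˡ _ ⟩
        (b * b) * Q v ∎)

      b²Qv≈0⇒b≈0 : ∀ {b} → (b * b) * Q v ≈ 0# → b ≈ 0#
      b²Qv≈0⇒b≈0 {b} b²Qv≈0 = ≈-stable λ b≉0 → *-nonzero (*-nonzero b≉0 b≉0) Qv≉0 b²Qv≈0

    tangent : Tangent L
    tangent = u , u-nonZero L , OnLine-u L , Qu≈0 , λ r _ r∈L r∈E →
      let a , b , r≈ , Qr≈ = Q-on r∈L
      in a , λ i → trans (r≈ i) (trans (+-congˡ (trans (*-congʳ (b²Qv≈0⇒b≈0 (trans (sym Qr≈) r∈E))) (zeroˡ _))) (+-identityʳ _))

    inClass : ∀ C → (∀ {a b} → a ≈ b → C a → C b) → (∀ {l x} → ¬ l ≈ 0# → C x → C ((l * l) * x)) → C (Q v) → InClass C L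
    inClass C C-resp C-*ˡ CQv = tangent , λ r _ r∈L r∉E →
      let a , b , r≈ , Qr≈ = Q-on r∈L
          b≉0 : ¬ b ≈ 0#
          b≉0 b≈0 = r∉E (trans Qr≈ (trans (*-congʳ (trans (*-congʳ b≈0) (zeroˡ b))) (zeroˡ _)))
      in C-resp (sym Qr≈) (C-*ˡ b≉0 CQv)

module ThroughZ (F : FiniteField) (ω : FiniteField.Carrier F) (¬□ω : ¬ PG3.IsSquare F ω) where
  open FieldFacts F
  open Space F ω
  open Tangents F ω
  open NormForm F ω ¬□ω
  open SetoidReasoning setoid

  Z : V4
  Z = vec 0# 0# 0# 1#

  Z-nonZero : NonZero Z
  Z-nonZero Z≈0 = 1≉0 (Z≈0 X₄)

  Z∈E : OnE Z
  Z∈E = solve 1 (λ w → (𝟘 ⊗ 𝟘 ⊕ (⊝ (w ⊗ (𝟘 ⊗ 𝟘)))) ⊕ 𝟘 ⊗ 𝟙 := 𝟘) refl ω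

  polar-Z : ∀ w → polar Z w ≈ w X₃
  polar-Z w = solve 5 (λ w₁ w₂ w₃ w₄ o → ((𝟘 ⊗ w₁ ⊕ 𝟘 ⊗ w₁) ⊕ (⊝ (o ⊗ (𝟘 ⊗ w₂) ⊕ o ⊗ (𝟘 ⊗ w₂)))) ⊕ (𝟘 ⊗ w₄ ⊕ 𝟙 ⊗ w₃) := w₃)
    refl (w X₁) (w X₂) (w X₃) (w X₄) ω

  tangent-through-Z⇒X₃≈0 : ∀ L {w} → Tangent L → OnLine Z L → OnLine w L → w X₃ ≈ 0#
  tangent-through-Z⇒X₃≈0 L {w} tangent Z∈L w∈L = trans (sym (polar-Z w)) (tangent⇒polar≈0 L {Z} {w} tangent Z-nonZero Z∈L Z∈E w∈L)

  -- On the plane X₃ = 0, Q is the anisotropic norm form in X₁, X₂.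
  E∩[X₃≈0]≈Z : ∀ {P} → OnE P → P X₃ ≈ 0# → P ≈ᵥ scale (P X₄) Z
  E∩[X₃≈0]≈Z {P} P∈E P₃≈0 = λ where
      0F → trans (proj₁ P₁₂≈0) (sym (zeroʳ _))
      (sucF 0F) → trans (proj₂ P₁₂≈0) (sym (zeroʳ _))
      (sucF (sucF 0F)) → trans P₃≈0 (sym (zeroʳ _))
      (sucF (sucF (sucF 0F))) → sym (*-identityʳ _)
    where
    P₁₂≈0 = norm≈0⇒zero (trans (sym (trans (+-congˡ (trans (*-congʳ P₃≈0) (zeroˡ _))) (+-identityʳ _))) P∈E)

  -- Points of the tangent plane X₃ = 0 of E at Z, modulo Z.
  direction : Pair → V4
  direction (a , b) = vec a b 0# 0#

  Q-direction : ∀ c → Q (direction c) ≈ norm c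
  Q-direction (a , b) = solve 3 (λ a b w → (a ⊗ a ⊕ (⊝ (w ⊗ (b ⊗ b)))) ⊕ 𝟘 ⊗ 𝟘 := a ⊗ a ⊕ (⊝ (w ⊗ (b ⊗ b)))) refl a b ω

  polar-Z-direction : ∀ c → polar Z (direction c) ≈ 0#
  polar-Z-direction c = polar-Z (direction c)

  *-pair≈0 : ∀ {l} c → NonZeroPair c → l * proj₁ c ≈ 0# → l * proj₂ c ≈ 0# → l ≈ 0#
  *-pair≈0 c c≉0 la≈0 lb≈0 = ≈-stable λ l≉0 → c≉0 (*-cancelˡ-zero l≉0 la≈0 , *-cancelˡ-zero l≉0 lb≈0)

  lineZ : (c : Pair) → NonZeroPair c → Line
  lineZ c c≉0 = mkLine Z (direction c) λ a b ab≈0 →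
    trans (sym (solve 2 (λ a b → a ⊗ 𝟙 ⊕ b ⊗ 𝟘 := a) refl a b)) (ab≈0 X₄) ,
    *-pair≈0 c c≉0 (trans (sym (solve 3 (λ a b c → a ⊗ 𝟘 ⊕ b ⊗ c := b ⊗ c) refl a b (proj₁ c))) (ab≈0 X₁))
                   (trans (sym (solve 3 (λ a b c → a ⊗ 𝟘 ⊕ b ⊗ c := b ⊗ c) refl a b (proj₂ c))) (ab≈0 X₂))

  inClass-lineZ : ∀ C → (∀ {a b} → a ≈ b → C a → C b) → (∀ {l x} → ¬ l ≈ 0# → C x → C ((l * l) * x)) →
    ∀ c c≉0 → C (norm c) → InClass C (lineZ c c≉0)
  inClass-lineZ C C-resp C-*ˡ c c≉0 C-Nc = TangentLine.inClass (lineZ c c≉0) Z∈E (polar-Z-direction c)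
    (λ Q≈0 → norm-nonzero c≉0 (trans (sym (Q-direction c)) Q≈0)) C C-resp C-*ˡ (C-resp (sym (Q-direction c)) C-Nc)

  class-lineZ : ∀ C → (∀ {a b} → a ≈ b → C a → C b) → ∀ c c≉0 → InClass C (lineZ c c≉0) → C (norm c)
  class-lineZ C C-resp c c≉0 (_ , class) = C-resp (Q-direction c)
    (class (direction c) (λ d≈0 → c≉0 (d≈0 X₁ , d≈0 X₂)) (OnLine-v (lineZ c c≉0)) (λ Q≈0 → norm-nonzero c≉0 (trans (sym (Q-direction c)) Q≈0)))

  lineZ-cong : ∀ {c c′} c≉0 c′≉0 → c ≈₂ c′ → lineZ c c≉0 ≈L lineZ c′ c′≉0
  lineZ-cong {c} {c′} c≉0 c′≉0 (a≈ , b≈) =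
    (OnLine-u (lineZ c c≉0) , (0# , 1# , v≈ {z = Z} (≈ᵥ-sym d≈))) , (OnLine-u (lineZ c′ c′≉0) , (0# , 1# , v≈ {z = Z} d≈))
    where
    d≈ : direction c ≈ᵥ direction c′
    d≈ 0F = a≈
    d≈ (sucF 0F) = b≈
    d≈ (sucF (sucF 0F)) = refl
    d≈ (sucF (sucF (sucF 0F))) = refl
    v≈ : ∀ {x y z : V4} → x ≈ᵥ y → ∀ i → x i ≈ 0# * z i + 1# * y i
    v≈ x≈y i = trans (x≈y i) (sym (trans (+-cong (zeroˡ _) (*-identityˡ _)) (+-identityˡ _)))

  lineZ-· : ∀ {c} l c≉0 lc≉0 → ¬ l ≈ 0# → lineZ (l · c) lc≉0 ≈L lineZ c c≉0
  lineZ-· {c₁ , c₂} l c≉0 lc≉0 l≉0 =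
    (OnLine-u (lineZ (l · (c₁ , c₂)) lc≉0) , (0# , inv l l≉0 , λ where
      0F → unscale c₁
      (sucF 0F) → unscale c₂
      (sucF (sucF 0F)) → sym (trans (+-cong (zeroˡ _) (zeroʳ _)) (+-identityʳ 0#))
      (sucF (sucF (sucF 0F))) → sym (trans (+-cong (*-identityʳ 0#) (zeroʳ _)) (+-identityʳ 0#)))) ,
    (OnLine-u (lineZ (c₁ , c₂) c≉0) , (0# , l , λ where
      0F → sym (trans (+-congʳ (zeroˡ _)) (+-identityˡ _))
      (sucF 0F) → sym (trans (+-congʳ (zeroˡ _)) (+-identityˡ _))
      (sucF (sucF 0F)) → sym (trans (+-cong (zeroˡ _) (zeroʳ _)) (+-identityʳ 0#))
      (sucF (sucF (sucF 0F))) → sym (trans (+-cong (*-identityʳ 0#) (zeroʳ _)) (+-identityʳ 0#))))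
    where
    unscale : ∀ x → x ≈ 0# * 0# + inv l l≉0 * (l * x)
    unscale x = sym (begin
      0# * 0# + inv l l≉0 * (l * x) ≈⟨ trans (+-congʳ (zeroˡ 0#)) (+-identityˡ _) ⟩
      inv l l≉0 * (l * x) ≈⟨ *-assoc _ _ _ ⟨
      (inv l l≉0 * l) * x ≈⟨ trans (*-congʳ (*-inverseˡ l l≉0)) (*-identityˡ x) ⟩
      x ∎)

  tangent-through-Z : ∀ L → Tangent L → OnLine Z L → ∃ λ c → Σ (NonZeroPair c) λ c≉0 → L ≈L lineZ c c≉0
  tangent-through-Z L tangent Z∈L = c , c≉0 , ≈L-trans {L} {mkLine Z w indep} {lineZ c c≉0} (≈L-mkLine L Z∈L w∈L indep) span≈
    where
    second = second-point L Z∈L Z-nonZero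
    w = proj₁ second
    w∈L = proj₁ (proj₂ second)
    indep = proj₂ (proj₂ second)
    w₃≈0 : w X₃ ≈ 0#
    w₃≈0 = tangent-through-Z⇒X₃≈0 L tangent Z∈L w∈L
    c : Pair
    c = w X₁ , w X₂
    c≉0 : NonZeroPair c
    c≉0 (w₁≈0 , w₂≈0) = 1≉0 (trans (sym (-‿involutive 1#)) (trans (-‿cong (proj₂ (indep (w X₄) (- 1#) w∝Z))) -0#≈0#))
      where
      w∝Z : lin (w X₄) Z (- 1#) w ≈ᵥ 0ᵥ
      w∝Z 0F = trans (+-cong (zeroʳ _) (*-congˡ w₁≈0)) (trans (+-congˡ (zeroʳ _)) (+-identityʳ 0#))
      w∝Z (sucF 0F) = trans (+-cong (zeroʳ _) (*-congˡ w₂≈0)) (trans (+-congˡ (zeroʳ _)) (+-identityʳ 0#))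
      w∝Z (sucF (sucF 0F)) = trans (+-cong (zeroʳ _) (*-congˡ w₃≈0)) (trans (+-congˡ (zeroʳ _)) (+-identityʳ 0#))
      w∝Z (sucF (sucF (sucF 0F))) = solve 1 (λ x → x ⊗ 𝟙 ⊕ (⊝ 𝟙) ⊗ x := 𝟘) refl (w X₄)
    span≈ : mkLine Z w indep ≈L lineZ c c≉0
    span≈ = (OnLine-u (mkLine Z w indep) , (- w X₄ , 1# , λ where
              0F → solve 2 (λ x a → x := a ⊗ 𝟘 ⊕ 𝟙 ⊗ x) refl (w X₁) (- w X₄)
              (sucF 0F) → solve 2 (λ x a → x := a ⊗ 𝟘 ⊕ 𝟙 ⊗ x) refl (w X₂) (- w X₄)
              (sucF (sucF 0F)) → sym (trans (+-cong (zeroʳ _) (trans (*-congˡ w₃≈0) (zeroʳ _))) (+-identityʳ 0#))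
              (sucF (sucF (sucF 0F))) → solve 1 (λ x → 𝟘 := (⊝ x) ⊗ 𝟙 ⊕ 𝟙 ⊗ x) refl (w X₄))) ,
            (OnLine-u (lineZ c c≉0) , (w X₄ , 1# , λ where
              0F → solve 2 (λ x a → x := a ⊗ 𝟘 ⊕ 𝟙 ⊗ x) refl (w X₁) (w X₄)
              (sucF 0F) → solve 2 (λ x a → x := a ⊗ 𝟘 ⊕ 𝟙 ⊗ x) refl (w X₂) (w X₄)
              (sucF (sucF 0F)) → trans w₃≈0 (sym (trans (+-cong (zeroʳ _) (zeroʳ _)) (+-identityʳ 0#)))
              (sucF (sucF (sucF 0F))) → solve 1 (λ x → x := x ⊗ 𝟙 ⊕ 𝟙 ⊗ 𝟘) refl (w X₄)))

module Neighbours (F : FiniteField) (ω : FiniteField.Carrier F) (¬□ω : ¬ PG3.IsSquare F ω)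
                  (A : FiniteField.Carrier F × FiniteField.Carrier F) (A≉0 : NormForm.NonZeroPair F ω ¬□ω A) where
  open FieldFacts F
  open Space F ω
  open Tangents F ω
  open NormForm F ω ¬□ω
  open ThroughZ F ω ¬□ω
  open SetoidReasoning setoid

  α β : Carrier
  α = proj₁ A
  β = proj₂ A

  ℓ₀ : Line
  ℓ₀ = lineZ A A≉0

  X₃≈0-on-ℓ₀ : ∀ {r} → OnLine r ℓ₀ → r X₃ ≈ 0#
  X₃≈0-on-ℓ₀ (a , b , r≈) = trans (r≈ X₃) (solve 2 (λ a b → a ⊗ 𝟘 ⊕ b ⊗ 𝟘 := 𝟘) refl a b)

  -- The points of E off the plane X₃ = 0, normalised to X₃ = 1.
  onE-point : Pair → V4
  onE-point (x , y) = vec x y 1# (- norm (x , y))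

  onE-point∈E : ∀ p → OnE (onE-point p)
  onE-point∈E (x , y) = solve 3 (λ x y w → (x ⊗ x ⊕ (⊝ (w ⊗ (y ⊗ y)))) ⊕ 𝟙 ⊗ (⊝ (x ⊗ x ⊕ (⊝ (w ⊗ (y ⊗ y))))) := 𝟘) refl x y ω

  polar-A : Pair → Carrier
  polar-A (x , y) = (x * α + x * α) - (ω * (y * β) + ω * (y * β))

  -- The point of ℓ₀ conjugate to onE-point p.
  ℓ₀-point : Pair → V4
  ℓ₀-point p = vec α β 0# (- polar-A p)

  Q-ℓ₀-point : ∀ p → Q (ℓ₀-point p) ≈ norm A
  Q-ℓ₀-point p = solve 4 (λ a b w t → (a ⊗ a ⊕ (⊝ (w ⊗ (b ⊗ b)))) ⊕ 𝟘 ⊗ t := a ⊗ a ⊕ (⊝ (w ⊗ (b ⊗ b)))) refl α β ω (- polar-A p)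

  polar-onE-ℓ₀ : ∀ p → polar (onE-point p) (ℓ₀-point p) ≈ 0#
  polar-onE-ℓ₀ (x , y) = solve 5 (λ x y a b w →
    ((x ⊗ a ⊕ x ⊗ a) ⊕ (⊝ (w ⊗ (y ⊗ b) ⊕ w ⊗ (y ⊗ b)))) ⊕ (𝟙 ⊗ (⊝ ((x ⊗ a ⊕ x ⊗ a) ⊕ (⊝ (w ⊗ (y ⊗ b) ⊕ w ⊗ (y ⊗ b))))) ⊕ (⊝ (x ⊗ x ⊕ (⊝ (w ⊗ (y ⊗ y))))) ⊗ 𝟘)
    := 𝟘) refl x y α β ω

  ℓ₀-point-nonZero : ∀ p → NonZero (ℓ₀-point p)
  ℓ₀-point-nonZero p R≈0 = A≉0 (R≈0 X₁ , R≈0 X₂)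

  ℓ₀-point∈ℓ₀ : ∀ p → OnLine (ℓ₀-point p) ℓ₀
  ℓ₀-point∈ℓ₀ p = - polar-A p , 1# , λ where
    0F → solve 2 (λ t a → a := t ⊗ 𝟘 ⊕ 𝟙 ⊗ a) refl (- polar-A p) α
    (sucF 0F) → solve 2 (λ t a → a := t ⊗ 𝟘 ⊕ 𝟙 ⊗ a) refl (- polar-A p) β
    (sucF (sucF 0F)) → solve 1 (λ t → 𝟘 := t ⊗ 𝟘 ⊕ 𝟙 ⊗ 𝟘) refl (- polar-A p)
    (sucF (sucF (sucF 0F))) → solve 1 (λ t → t := t ⊗ 𝟙 ⊕ 𝟙 ⊗ 𝟘) refl (- polar-A p)

  lineT : Pair → Line
  lineT p@(x , y) = mkLine (onE-point p) (ℓ₀-point p) λ a b ab≈0 →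
    let a≈0 = trans (sym (solve 2 (λ a b → a ⊗ 𝟙 ⊕ b ⊗ 𝟘 := a) refl a b)) (ab≈0 X₃)
        b≈0 = *-pair≈0 A A≉0 (trans (sym (trans (+-congʳ (trans (*-congʳ a≈0) (zeroˡ x))) (+-identityˡ _))) (ab≈0 X₁))
                              (trans (sym (trans (+-congʳ (trans (*-congʳ a≈0) (zeroˡ y))) (+-identityˡ _))) (ab≈0 X₂))
    in a≈0 , b≈0

  inClass-lineT : ∀ C → (∀ {a b} → a ≈ b → C a → C b) → (∀ {l x} → ¬ l ≈ 0# → C x → C ((l * l) * x)) →
    C (norm A) → ∀ p → InClass C (lineT p)
  inClass-lineT C C-resp C-*ˡ C-NA p = TangentLine.inClass (lineT p) (onE-point∈E p) (polar-onE-ℓ₀ p)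
    (λ Q≈0 → norm-nonzero A≉0 (trans (sym (Q-ℓ₀-point p)) Q≈0)) C C-resp C-*ˡ (C-resp (sym (Q-ℓ₀-point p)) C-NA)

  class-lineT : ∀ C → (∀ {a b} → a ≈ b → C a → C b) → ∀ p → InClass C (lineT p) → C (norm A)
  class-lineT C C-resp p (_ , class) = C-resp (Q-ℓ₀-point p) (class (ℓ₀-point p) (ℓ₀-point-nonZero p) (OnLine-v (lineT p))
    (λ Q≈0 → norm-nonzero A≉0 (trans (sym (Q-ℓ₀-point p)) Q≈0)))

  meet-lineT : ∀ p → MeetInOnePoint (lineT p) ℓ₀
  meet-lineT p = ℓ₀-point p , ℓ₀-point-nonZero p , OnLine-v (lineT p) , ℓ₀-point∈ℓ₀ p , λ r _ (a , b , r≈) r∈ℓ₀ →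
    let a≈0 = trans (sym (solve 2 (λ a b → a ⊗ 𝟙 ⊕ b ⊗ 𝟘 := a) refl a b)) (trans (sym (r≈ X₃)) (X₃≈0-on-ℓ₀ r∈ℓ₀))
    in b , λ i → trans (r≈ i) (trans (+-congʳ (trans (*-congʳ a≈0) (zeroˡ _))) (+-identityˡ _))

  meet-lineZ : ∀ c c≉0 → ¬ det c A ≈ 0# → MeetInOnePoint (lineZ c c≉0) ℓ₀
  meet-lineZ c@(c₁ , c₂) c≉0 det≉0 = Z , Z-nonZero , OnLine-u (lineZ c c≉0) , OnLine-u ℓ₀ , λ r _ (a , b , r≈) (d , e , r≈′) →
    let drop-Z : ∀ {a b x} i → Z i ≈ 0# → a * Z i + b * x ≈ b * x
        drop-Z i Zi≈0 = trans (+-congʳ (trans (*-congˡ Zi≈0) (zeroʳ _))) (+-identityˡ _)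
        bc≈eA : ∀ i → Z i ≈ 0# → b * direction c i ≈ e * direction A i
        bc≈eA i Zi≈0 = trans (sym (drop-Z i Zi≈0)) (trans (sym (r≈ i)) (trans (r≈′ i) (drop-Z i Zi≈0)))
        b≈0 = *-cancelʳ-zero det≉0 (begin
          b * det c A ≈⟨ solve 5 (λ b c₁ c₂ a₁ a₂ → b ⊗ (c₁ ⊗ a₂ ⊕ (⊝ (c₂ ⊗ a₁))) := (b ⊗ c₁) ⊗ a₂ ⊕ (⊝ ((b ⊗ c₂) ⊗ a₁))) refl b c₁ c₂ α β ⟩
          (b * c₁) * β - (b * c₂) * α ≈⟨ +-cong (*-congʳ (bc≈eA X₁ refl)) (-‿cong (*-congʳ (bc≈eA X₂ refl))) ⟩
          (e * α) * β - (e * β) * α ≈⟨ solve 3 (λ e a b → (e ⊗ a) ⊗ b ⊕ (⊝ ((e ⊗ b) ⊗ a)) := 𝟘) refl e α β ⟩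
          0# ∎)
    in a , λ i → trans (r≈ i) (trans (+-congˡ (trans (*-congʳ b≈0) (zeroˡ _))) (+-identityʳ _))

  data Neighbour (m : Line) : Set where
    viaE : ∀ p → m ≈L lineT p → Neighbour m
    viaZ : ∀ c (n : Normalised c) → ¬ det c A ≈ 0# → m ≈L lineZ c (normalised-nonzero n) → Neighbour m

  private
    on-ℓ₀ : ∀ {r d e} → r ≈ᵥ lin d Z e (direction A) → r X₁ ≈ e * α × r X₂ ≈ e * β × r X₄ ≈ d
    on-ℓ₀ {d = d} {e} r≈ =
      trans (r≈ X₁) (solve 3 (λ d e a → d ⊗ 𝟘 ⊕ e ⊗ a := e ⊗ a) refl d e α) ,
      trans (r≈ X₂) (solve 3 (λ d e a → d ⊗ 𝟘 ⊕ e ⊗ a := e ⊗ a) refl d e β) ,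
      trans (r≈ X₄) (solve 2 (λ d e → d ⊗ 𝟙 ⊕ e ⊗ 𝟘 := d) refl d e)

  Z∈⇒direction-A∉ : ∀ {m} → MeetInOnePoint m ℓ₀ → OnLine Z m → ¬ OnLine (direction A) m
  Z∈⇒direction-A∉ (R , _ , _ , _ , unique) Z∈m A∈m = A≉0 (vanishes X₁ refl , vanishes X₂ refl)
    where
    Z≈ = unique Z Z-nonZero Z∈m (OnLine-u ℓ₀)
    A≈ = proj₂ (unique (direction A) (λ A≈0 → A≉0 (A≈0 X₁ , A≈0 X₂)) A∈m (OnLine-v ℓ₀))
    c≉0 : ¬ proj₁ Z≈ ≈ 0#
    c≉0 c≈0 = 1≉0 (trans (proj₂ Z≈ X₄) (trans (*-congʳ c≈0) (zeroˡ _)))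
    vanishes : ∀ i → Z i ≈ 0# → direction A i ≈ 0#
    vanishes i Zi≈0 = trans (A≈ i) (trans (*-congˡ (*-cancelˡ-zero c≉0 (trans (sym (proj₂ Z≈ i)) Zi≈0))) (zeroʳ _))

  neighbour-through-Z : ∀ m → Tangent m → MeetInOnePoint m ℓ₀ → OnLine Z m → Neighbour m
  neighbour-through-Z m tangent meet Z∈m = viaZ n (normalised-normalise c) det≉0 m≈m′
    where
    through = tangent-through-Z m tangent Z∈m
    c = proj₁ through
    c≉0 = proj₁ (proj₂ through)
    scaling = normalise-scale c c≉0
    l = proj₁ scaling
    c≈ln = proj₂ (proj₂ scaling)
    n = normalise c
    m′ = lineZ n (normalised-nonzero (normalised-normalise c))
    ln≉0 : NonZeroPair (l · n)
    ln≉0 (z₁ , z₂) = c≉0 (trans (proj₁ c≈ln) z₁ , trans (proj₂ c≈ln) z₂)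
    m≈m′ : m ≈L m′
    m≈m′ = ≈L-trans {m} {lineZ c c≉0} {m′} (proj₂ (proj₂ through))
      (≈L-trans {lineZ c c≉0} {lineZ (l · n) ln≉0} {m′} (lineZ-cong c≉0 ln≉0 c≈ln)
        (lineZ-· l (normalised-nonzero (normalised-normalise c)) ln≉0 (proj₁ (proj₂ scaling))))
    det≉0 : ¬ det n A ≈ 0#
    det≉0 det≈0 = Z∈⇒direction-A∉ {m} meet Z∈m (OnLine-≈L {m′} {m} (≈L-sym {m} {m′} m≈m′) (0# , μ , λ where
        0F → trans α≈ (sym (trans (+-congʳ (zeroˡ _)) (+-identityˡ _)))
        (sucF 0F) → trans β≈ (sym (trans (+-congʳ (zeroˡ _)) (+-identityˡ _)))
        (sucF (sucF 0F)) → solve 1 (λ x → 𝟘 := 𝟘 ⊗ 𝟘 ⊕ x ⊗ 𝟘) refl μ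
        (sucF (sucF (sucF 0F))) → solve 1 (λ x → 𝟘 := 𝟘 ⊗ 𝟙 ⊕ x ⊗ 𝟘) refl μ))
      where
      proportional = det≈0⇒∝ A (normalised-normalise c) det≈0
      μ = proj₁ proportional
      α≈ = proj₁ (proj₂ proportional)
      β≈ = proj₂ (proj₂ proportional)

  dehomogenise : (P : V4) → ¬ P X₃ ≈ 0# → Pair
  dehomogenise P P₃≉0 = inv (P X₃) P₃≉0 * P X₁ , inv (P X₃) P₃≉0 * P X₂

  onE-point-dehomogenise : ∀ {P : V4} → OnE P → (P₃≉0 : ¬ P X₃ ≈ 0#) → onE-point (dehomogenise P P₃≉0) ≈ᵥ scale (inv (P X₃) P₃≉0) P
  onE-point-dehomogenise {P} P∈E P₃≉0 = λ where
      0F → refl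
      (sucF 0F) → refl
      (sucF (sucF 0F)) → sym (*-inverseˡ (P X₃) P₃≉0)
      (sucF (sucF (sucF 0F))) → sym (x+y≈0⇒y≈-x (begin
        norm p + P₃⁻¹ * P X₄ ≈⟨ +-congˡ (trans (*-congʳ (*-inverseˡ (P X₃) P₃≉0)) (*-identityˡ _)) ⟨
        norm p + (P₃⁻¹ * P X₃) * (P₃⁻¹ * P X₄) ≈⟨ solve 6 (λ i p₁ p₂ p₃ p₄ w →
          ((i ⊗ p₁) ⊗ (i ⊗ p₁) ⊕ (⊝ (w ⊗ ((i ⊗ p₂) ⊗ (i ⊗ p₂))))) ⊕ (i ⊗ p₃) ⊗ (i ⊗ p₄)
          := (i ⊗ i) ⊗ ((p₁ ⊗ p₁ ⊕ (⊝ (w ⊗ (p₂ ⊗ p₂)))) ⊕ p₃ ⊗ p₄)) refl P₃⁻¹ (P X₁) (P X₂) (P X₃) (P X₄) ω ⟩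
        (P₃⁻¹ * P₃⁻¹) * Q P ≈⟨ trans (*-congˡ P∈E) (zeroʳ _) ⟩
        0# ∎))
    where
    P₃⁻¹ = inv (P X₃) P₃≉0
    p = dehomogenise P P₃≉0

  polar-onE-point : ∀ p {R : V4} {d e} → R ≈ᵥ lin d Z e (direction A) → polar (onE-point p) R ≈ d + e * polar-A p
  polar-onE-point p {R} {d} {e} R≈ = trans (polar-cong {onE-point p} ≈ᵥ-refl R≈) (solve 8 (λ x y t d e a b w →
    ((x ⊗ (d ⊗ 𝟘 ⊕ e ⊗ a) ⊕ x ⊗ (d ⊗ 𝟘 ⊕ e ⊗ a)) ⊕ (⊝ (w ⊗ (y ⊗ (d ⊗ 𝟘 ⊕ e ⊗ b)) ⊕ w ⊗ (y ⊗ (d ⊗ 𝟘 ⊕ e ⊗ b)))))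
      ⊕ (𝟙 ⊗ (d ⊗ 𝟙 ⊕ e ⊗ 𝟘) ⊕ t ⊗ (d ⊗ 𝟘 ⊕ e ⊗ 𝟘))
    := d ⊕ e ⊗ ((x ⊗ a ⊕ x ⊗ a) ⊕ (⊝ (w ⊗ (y ⊗ b) ⊕ w ⊗ (y ⊗ b))))) refl (proj₁ p) (proj₂ p) (- norm p) d e α β ω)

  e≉0⇒Z∉ : ∀ {m : Line} {R : V4} {d e} → R ≈ᵥ lin d Z e (direction A) → (∀ r → NonZero r → OnLine r m → OnLine r ℓ₀ → SamePoint r R) →
    ¬ e ≈ 0# → ¬ OnLine Z m
  e≉0⇒Z∉ {R = R} {d} {e} R≈ unique-R e≉0 Z∈m = Z-nonZero λ i → trans (proj₂ Z≈ i) (trans (*-congʳ c≈0) (zeroˡ _))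
    where
    Z≈ = unique-R Z Z-nonZero Z∈m (OnLine-u ℓ₀)
    c≈0 : proj₁ Z≈ ≈ 0#
    c≈0 = *-cancelʳ-zero e≉0 (*-pair≈0 A A≉0
      (trans (*-assoc _ e α) (trans (*-congˡ (sym (proj₁ (on-ℓ₀ R≈)))) (sym (proj₂ Z≈ X₁))))
      (trans (*-assoc _ e β) (trans (*-congˡ (sym (proj₁ (proj₂ (on-ℓ₀ R≈))))) (sym (proj₂ Z≈ X₂)))))

  neighbour-off-Z : ∀ m → Tangent m → ∀ {R d e} → OnLine R m → R ≈ᵥ lin d Z e (direction A) →
    (∀ r → NonZero r → OnLine r m → OnLine r ℓ₀ → SamePoint r R) → ¬ e ≈ 0# → Neighbour m
  neighbour-off-Z m tangent@(P , P≉0 , P∈m , P∈E , _) {R} {d} {e} R∈m R≈ unique-R e≉0 =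
    viaE p (≈L-mkLine m T∈m ℓ₀-point∈m (Line.indep (lineT p)))
    where
    P₃≉0 : ¬ P X₃ ≈ 0#
    P₃≉0 P₃≈0 = e≉0⇒Z∉ {m} R≈ unique-R e≉0 (OnLine-unscale m P₄≉0 P≈P₄Z P∈m)
      where
      P≈P₄Z = E∩[X₃≈0]≈Z P∈E P₃≈0
      P₄≉0 : ¬ P X₄ ≈ 0#
      P₄≉0 P₄≈0 = P≉0 λ i → trans (P≈P₄Z i) (trans (*-congʳ P₄≈0) (zeroˡ _))
    p = dehomogenise P P₃≉0
    T∈m : OnLine (onE-point p) m
    T∈m = OnLine-resp m (≈ᵥ-sym (onE-point-dehomogenise P∈E P₃≉0)) (OnLine-scale m (inv (P X₃) P₃≉0) P∈m)
    e·polar≈-d : e * polar-A p ≈ - d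
    e·polar≈-d = x+y≈0⇒y≈-x (trans (sym (polar-onE-point p R≈))
      (tangent⇒polar≈0 m {onE-point p} {R} tangent (λ T≈0 → 1≉0 (T≈0 X₃)) T∈m (onE-point∈E p) R∈m))
    R≈eR′ : R ≈ᵥ scale e (ℓ₀-point p)
    R≈eR′ 0F = proj₁ (on-ℓ₀ R≈)
    R≈eR′ (sucF 0F) = proj₁ (proj₂ (on-ℓ₀ R≈))
    R≈eR′ (sucF (sucF 0F)) = trans (X₃≈0-on-ℓ₀ (d , e , R≈)) (sym (zeroʳ e))
    R≈eR′ (sucF (sucF (sucF 0F))) = begin
      R X₄ ≈⟨ proj₂ (proj₂ (on-ℓ₀ R≈)) ⟩
      d ≈⟨ -‿involutive d ⟨
      - - d ≈⟨ -‿cong e·polar≈-d ⟨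
      - (e * polar-A p) ≈⟨ -‿distribʳ-* e (polar-A p) ⟩
      e * - polar-A p ∎
    ℓ₀-point∈m : OnLine (ℓ₀-point p) m
    ℓ₀-point∈m = OnLine-unscale m e≉0 R≈eR′ R∈m

  neighbour : ∀ m → Tangent m → MeetInOnePoint m ℓ₀ → Neighbour m
  neighbour m tangent meet@(R , R≉0 , R∈m , (d , e , R≈) , unique) with e ≟ 0#
  ... | no e≉0 = neighbour-off-Z m tangent R∈m R≈ unique e≉0
  ... | yes e≈0 = neighbour-through-Z m tangent meet (OnLine-unscale m d≉0 R≈dZ R∈m)
    where
    R≈dZ : R ≈ᵥ scale d Z
    R≈dZ i = trans (R≈ i) (trans (+-congˡ (trans (*-congʳ e≈0) (zeroˡ _))) (+-identityʳ _))
    d≉0 : ¬ d ≈ 0#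
    d≉0 d≈0 = R≉0 λ i → trans (R≈dZ i) (trans (*-congʳ d≈0) (zeroˡ _))

-- A property of field elements invariant under multiplication by non-zero squares; used for
-- "is a square" and "is a non-square" simultaneously, which swaps the roles of 𝓛₀ and 𝓛₁.
record SquareInvariant (F : FiniteField) : Set₁ where
  open FiniteField F
  field
    Holds : Carrier → Set
    resp : ∀ {a b} → a ≈ b → Holds a → Holds b
    *ˡ : ∀ {l x} → ¬ l ≈ 0# → Holds x → Holds ((l * l) * x)
    /ˡ : ∀ {l x} → ¬ l ≈ 0# → Holds ((l * l) * x) → Holds x

squares nonSquares : (F : FiniteField) → SquareInvariant F
squares F = record { Holds = IsSquare ; resp = isSquare-resp ; *ˡ = λ _ → isSquare-*ˡ ; /ˡ = isSquare-/ˡ }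
  where
  open FieldFacts F
  open PG3 F using (IsSquare)
nonSquares F = record
  { Holds = λ x → ¬ IsSquare x ; resp = λ a≈b ¬□a □b → ¬□a (isSquare-resp (sym a≈b) □b)
  ; *ˡ = λ l≉0 ¬□x □l²x → ¬□x (isSquare-/ˡ l≉0 □l²x) ; /ˡ = λ _ ¬□l²x □x → ¬□l²x (isSquare-*ˡ □x) }
  where
  open FieldFacts F
  open PG3 F using (IsSquare)

module NeighbourCount (F : FiniteField) (ω : FiniteField.Carrier F) (¬□ω : ¬ PG3.IsSquare F ω)
                      (A : FiniteField.Carrier F × FiniteField.Carrier F) (A≉0 : NormForm.NonZeroPair F ω ¬□ω A)
                      (C C′ : SquareInvariant F) (C∩C′≡∅ : ∀ {x} → SquareInvariant.Holds C x → ¬ SquareInvariant.Holds C′ x)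
                      (C-A : SquareInvariant.Holds C (NormForm.norm F ω ¬□ω A))
                      (hasCard-C : Counting.HasCard (NormForm.Pairs F ω ¬□ω)
                                     (λ c → NormForm.Normalised F ω ¬□ω c × SquareInvariant.Holds C (NormForm.norm F ω ¬□ω c))
                                     (NormForm.#half F ω ¬□ω))
                      (hasCard-C′ : Counting.HasCard (NormForm.Pairs F ω ¬□ω)
                                     (λ c → NormForm.Normalised F ω ¬□ω c × SquareInvariant.Holds C′ (NormForm.norm F ω ¬□ω c))
                                     (NormForm.#half F ω ¬□ω)) where
  open FieldFacts F
  open Space F ω
  open Tangents F ω
  open NormForm F ω ¬□ω
  open ThroughZ F ω ¬□ω
  open Neighbours F ω ¬□ω A A≉0
  open SetoidReasoning setoid
  module C = SquareInvariant C
  module C′ = SquareInvariant C′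

  lineT-cong : ∀ {p p′} → p ≈₂ p′ → lineT p ≈L lineT p′
  lineT-cong {p} {p′} p≈p′ = (coincide p≈p′ , coincide′ p≈p′) , (coincide (Setoid.sym Pairs p≈p′) , coincide′ (Setoid.sym Pairs p≈p′))
    where
    onE≈ : ∀ {p p′} → p ≈₂ p′ → onE-point p ≈ᵥ onE-point p′
    onE≈ (x≈ , y≈) 0F = x≈
    onE≈ (x≈ , y≈) (sucF 0F) = y≈
    onE≈ (x≈ , y≈) (sucF (sucF 0F)) = refl
    onE≈ (x≈ , y≈) (sucF (sucF (sucF 0F))) = -‿cong (norm-cong (x≈ , y≈))
    ℓ₀≈ : ∀ {p p′} → p ≈₂ p′ → ℓ₀-point p ≈ᵥ ℓ₀-point p′
    ℓ₀≈ (x≈ , y≈) 0F = refl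
    ℓ₀≈ (x≈ , y≈) (sucF 0F) = refl
    ℓ₀≈ (x≈ , y≈) (sucF (sucF 0F)) = refl
    ℓ₀≈ (x≈ , y≈) (sucF (sucF (sucF 0F))) = -‿cong (+-cong (+-cong (*-congʳ x≈) (*-congʳ x≈))
      (-‿cong (+-cong (*-congˡ (*-congʳ y≈)) (*-congˡ (*-congʳ y≈)))))
    coincide : ∀ {p p′} → p ≈₂ p′ → OnLine (onE-point p′) (lineT p)
    coincide {p} p≈p′ = OnLine-resp (lineT p) (onE≈ p≈p′) (OnLine-u (lineT p))
    coincide′ : ∀ {p p′} → p ≈₂ p′ → OnLine (ℓ₀-point p′) (lineT p)
    coincide′ {p} p≈p′ = OnLine-resp (lineT p) (ℓ₀≈ p≈p′) (OnLine-v (lineT p))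

  -- lineT p meets E only in onE-point p.
  lineT-injective : ∀ p p′ → lineT p ≈L lineT p′ → p ≈₂ p′
  lineT-injective p p′ ((T′∈lineT , _) , _) = sym (trans (T′≈ X₁) c≈1) , sym (trans (T′≈ X₂) c≈1)
    where
    tangent = TangentLine.tangent (lineT p) (onE-point∈E p) (polar-onE-ℓ₀ p) (λ Q≈0 → norm-nonzero A≉0 (trans (sym (Q-ℓ₀-point p)) Q≈0))
    same = proj₂ (proj₂ (proj₂ (proj₂ tangent))) (onE-point p′) (λ T′≈0 → 1≉0 (T′≈0 X₃)) T′∈lineT (onE-point∈E p′)
    T′≈ = proj₂ same
    c≈1 : ∀ {x} → proj₁ same * x ≈ x
    c≈1 = trans (*-congʳ (sym (trans (T′≈ X₃) (*-identityʳ _)))) (*-identityˡ _)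

  IsLineT : Line → Set
  IsLineT m = ∃ λ p → m ≈L lineT p

  hasSize-lineT : HasSize IsLineT (order ℕ.* order)
  hasSize-lineT = hasCard-transport Pairs Lines (hasCard-× setoid setoid (Squares.hasCard-elements F) (Squares.hasCard-elements F)) lineT
    (λ {p} _ → p , ≈L-refl {lineT p}) (λ {p} {p′} _ _ → lineT-injective p p′) (λ (p , m≈) → p , (tt , tt) , m≈) lineT-cong

  Z∉lineT : ∀ p → ¬ OnLine Z (lineT p)
  Z∉lineT p (a , b , Z≈) = 1≉0 (trans (Z≈ X₄) (trans (+-cong (trans (*-congʳ a≈0) (zeroˡ _)) (trans (*-congʳ b≈0) (zeroˡ _))) (+-identityʳ 0#)))
    where
    a≈0 : a ≈ 0#
    a≈0 = sym (trans (Z≈ X₃) (solve 2 (λ a b → a ⊗ 𝟙 ⊕ b ⊗ 𝟘 := a) refl a b))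
    b≈0 : b ≈ 0#
    b≈0 = *-pair≈0 A A≉0 (sym (trans (Z≈ X₁) (trans (+-congʳ (trans (*-congʳ a≈0) (zeroˡ _))) (+-identityˡ _))))
                         (sym (trans (Z≈ X₂) (trans (+-congʳ (trans (*-congʳ a≈0) (zeroˡ _))) (+-identityˡ _))))

  lineZ′ : Pair → Line
  lineZ′ c = lineZ (normalise c) (normalised-nonzero (normalised-normalise c))

  lineZ′-cong : ∀ {c c′} → c ≈₂ c′ → lineZ′ c ≈L lineZ′ c′
  lineZ′-cong {c} {c′} c≈c′ = lineZ-cong (normalised-nonzero (normalised-normalise c)) (normalised-nonzero (normalised-normalise c′)) (normalise-cong c≈c′)

  lineZ′-injective : ∀ {c c′} → Normalised c → Normalised c′ → lineZ′ c ≈L lineZ′ c′ → c ≈₂ c′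
  lineZ′-injective {c} {c′} n n′ ((_ , (a , b , n′≈)) , _) =
    Setoid.trans Pairs (Setoid.sym Pairs (normalise-normalised n)) (Setoid.trans Pairs same (normalise-normalised n′))
    where
    drop-Z : ∀ i → Z i ≈ 0# → a * Z i + b * direction (normalise c) i ≈ b * direction (normalise c) i
    drop-Z i Zi≈0 = trans (+-congʳ (trans (*-congˡ Zi≈0) (zeroʳ a))) (+-identityˡ _)
    same : normalise c ≈₂ normalise c′
    same = det≈0⇒≈ (normalised-normalise c) (normalised-normalise c′) (begin
      det (normalise c) (normalise c′) ≈⟨ det-cong (Setoid.refl Pairs) (trans (n′≈ X₁) (drop-Z X₁ refl) , trans (n′≈ X₂) (drop-Z X₂ refl)) ⟩
      det (normalise c) (b · normalise c) ≈⟨ det-·ʳ (normalise c) b (normalise c) ⟩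
      b * det (normalise c) (normalise c) ≈⟨ trans (*-congˡ (det-self _)) (zeroʳ b) ⟩
      0# ∎)

  ClassC ClassC′ : Pair → Set
  ClassC c = Normalised c × C.Holds (norm c)
  ClassC′ c = Normalised c × C′.Holds (norm c)

  normalised-class : ∀ {c} (H : SquareInvariant F) → Normalised c → SquareInvariant.Holds H (norm c) →
    SquareInvariant.Holds H (norm (normalise c))
  normalised-class {c} H n Hc = SquareInvariant.resp H (norm-cong (Setoid.sym Pairs (normalise-normalised n))) Hc

  -- A pair proportional to A has the class of A.
  ClassC′⇒det≉0 : ∀ {c} → ClassC′ c → ¬ det c A ≈ 0#
  ClassC′⇒det≉0 {c} (n , C′-c) det≈0 = C∩C′≡∅ C-A (C′.resp (sym NA≈) (C′.*ˡ μ≉0 C′-c))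
    where
    proportional = det≈0⇒∝ A n det≈0
    μ = proj₁ proportional
    NA≈ : norm A ≈ (μ * μ) * norm c
    NA≈ = trans (norm-cong (proj₁ (proj₂ proportional) , proj₂ (proj₂ proportional))) (norm-· μ c)
    μ≉0 : ¬ μ ≈ 0#
    μ≉0 μ≈0 = A≉0 (trans (proj₁ (proj₂ proportional)) (trans (*-congʳ μ≈0) (zeroˡ _)) ,
                   trans (proj₂ (proj₂ proportional)) (trans (*-congʳ μ≈0) (zeroˡ _)))

  hasSize-otherClass : HasSize (λ m → InClass C′.Holds m × MeetInOnePoint m ℓ₀) #half
  hasSize-otherClass = hasCard-transport Pairs Lines hasCard-C′ lineZ′ neighbour-lineZ′
    (λ (n , _) (n′ , _) → lineZ′-injective n n′) (λ {m} (inC′ , meet) → from-neighbour m inC′ (neighbour m (proj₁ inC′) meet)) lineZ′-cong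
    where
    neighbour-lineZ′ : ∀ {c} → ClassC′ c → InClass C′.Holds (lineZ′ c) × MeetInOnePoint (lineZ′ c) ℓ₀
    neighbour-lineZ′ {c} (n , C′-c) =
      inClass-lineZ C′.Holds C′.resp C′.*ˡ (normalise c) (normalised-nonzero (normalised-normalise c)) (normalised-class C′ n C′-c) ,
      meet-lineZ (normalise c) (normalised-nonzero (normalised-normalise c)) (ClassC′⇒det≉0 (normalised-normalise c , normalised-class C′ n C′-c))
    from-neighbour : ∀ m → InClass C′.Holds m → Neighbour m → ∃ λ c → ClassC′ c × m ≈L lineZ′ c
    from-neighbour m inC′ (viaE p m≈) = ⊥-elim (C∩C′≡∅ C-A (class-lineT C′.Holds C′.resp p (inClass-resp C′.Holds {m} {lineT p} m≈ inC′)))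
    from-neighbour m inC′ (viaZ c n _ m≈) =
      c , (n , class-lineZ C′.Holds C′.resp c c≉0 (inClass-resp C′.Holds {m} {lineZ c c≉0} m≈ inC′)) ,
      ≈L-trans {m} {lineZ c c≉0} {lineZ′ c} m≈ (lineZ-cong c≉0 (normalised-nonzero (normalised-normalise c)) (Setoid.sym Pairs (normalise-normalised n)))
      where c≉0 = normalised-nonzero n

  private
    scalingA = normalise-scale A A≉0
    Â = normalise A
    lA = proj₁ scalingA
    lA≉0 = proj₁ (proj₂ scalingA)
    A≈lÂ = proj₂ (proj₂ scalingA)

    det-A : ∀ c → det c A ≈ lA * det c Â
    det-A c = trans (det-cong (Setoid.refl Pairs) A≈lÂ) (det-·ʳ c lA Â)

    det? = Counting.partition Pairs (λ c → det c A ≟ 0#)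
      (λ c≈c′ det≈0 → trans (sym (det-cong c≈c′ (Setoid.refl Pairs))) det≈0) hasCard-C
    module Det? = Counting.Partition det?

    #parallel≡1 : Det?.#in ≡ 1
    #parallel≡1 = hasCard-unique Pairs Det?.inside
      (Counting.hasCard-cong Pairs to from (Counting.hasCard-singleton Pairs {ClassC} Â (normalised-normalise A , C-Â)))
      where
      C-Â : C.Holds (norm Â)
      C-Â = C./ˡ lA≉0 (C.resp (trans (norm-cong A≈lÂ) (norm-· lA Â)) C-A)
      to : ∀ {c} → ClassC c × c ≈₂ Â → ClassC c × det c A ≈ 0#
      to {c} (cls , c≈Â) = cls , trans (det-A c) (trans (*-congˡ (trans (det-cong c≈Â (Setoid.refl Pairs)) (det-self Â))) (zeroʳ _))
      from : ∀ {c} → ClassC c × det c A ≈ 0# → ClassC c × c ≈₂ Â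
      from {c} (cls , det≈0) = cls , det≈0⇒≈ (proj₁ cls) (normalised-normalise A) (*-cancelˡ-zero lA≉0 (trans (sym (det-A c)) det≈0))

  hasCard-apart : Counting.HasCard Pairs (λ c → ClassC c × ¬ det c A ≈ 0#) (#half ℕ.∸ 1)
  hasCard-apart = ≡.subst (Counting.HasCard Pairs _) #out≡#half-1 Det?.outside
    where
    #out≡#half-1 : Det?.#out ≡ #half ℕ.∸ 1
    #out≡#half-1 = ≡.trans (≡.sym (ℕP.m+n∸m≡n 1 Det?.#out))
      (≡.cong (ℕ._∸ 1) (≡.trans (≡.cong (ℕ._+ Det?.#out) (≡.sym #parallel≡1)) Det?.#in+#out))

  IsLineZ : Line → Set
  IsLineZ m = ∃ λ c → (ClassC c × ¬ det c A ≈ 0#) × m ≈L lineZ′ c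

  hasSize-sameClass : HasSize (λ m → InClass C.Holds m × MeetInOnePoint m ℓ₀) (order ℕ.* order ℕ.+ (#half ℕ.∸ 1))
  hasSize-sameClass = Counting.hasCard-cong Lines {IsLineT ∪ IsLineZ} {λ m → InClass C.Holds m × MeetInOnePoint m ℓ₀}
    (λ {m} → to {m}) (λ {m} → from {m}) (Counting.hasCard-∪ Lines hasSize-lineT hasSize-lineZ (λ {m} {m′} → IsLineZ-resp {m} {m′}) (λ {m} → disjoint {m}))
    where
    IsLineZ-resp : Counting.Respects Lines IsLineZ
    IsLineZ-resp {m} {m′} m≈m′ (c , p , m≈) = c , p , ≈L-trans {m′} {m} {lineZ′ c} (≈L-sym {m} {m′} m≈m′) m≈
    disjoint : ∀ {m} → IsLineT m → ¬ IsLineZ m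
    disjoint {m} (p , m≈T) (c , _ , m≈Z) = Z∉lineT p
      (OnLine-≈L {lineZ′ c} {lineT p} (≈L-trans {lineZ′ c} {m} {lineT p} (≈L-sym {m} {lineZ′ c} m≈Z) m≈T) (OnLine-u (lineZ′ c)))
    hasSize-lineZ : HasSize IsLineZ (#half ℕ.∸ 1)
    hasSize-lineZ = hasCard-transport Pairs Lines hasCard-apart lineZ′ (λ {c} p → c , p , ≈L-refl {lineZ′ c})
      (λ ((n , _) , _) ((n′ , _) , _) → lineZ′-injective n n′) (λ (c , p , m≈) → c , p , m≈) lineZ′-cong
    to : ∀ {m} → IsLineT m ⊎ IsLineZ m → InClass C.Holds m × MeetInOnePoint m ℓ₀
    to {m} (inj₁ (p , m≈)) =
      inClass-resp C.Holds {lineT p} {m} (≈L-sym {m} {lineT p} m≈) (inClass-lineT C.Holds C.resp C.*ˡ C-A p) ,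
      meet-resp {lineT p} {m} {ℓ₀} {ℓ₀} (≈L-sym {m} {lineT p} m≈) (≈L-refl {ℓ₀}) (meet-lineT p)
    to {m} (inj₂ (c , ((n , C-c) , det≉0) , m≈)) =
      inClass-resp C.Holds {lineZ′ c} {m} (≈L-sym {m} {lineZ′ c} m≈)
        (inClass-lineZ C.Holds C.resp C.*ˡ (normalise c) (normalised-nonzero (normalised-normalise c)) (normalised-class C n C-c)) ,
      meet-resp {lineZ′ c} {m} {ℓ₀} {ℓ₀} (≈L-sym {m} {lineZ′ c} m≈) (≈L-refl {ℓ₀})
        (meet-lineZ (normalise c) (normalised-nonzero (normalised-normalise c))
          (λ det≈0 → det≉0 (trans (sym (det-cong (normalise-normalised n) (Setoid.refl Pairs))) det≈0)))
    from-neighbour : ∀ m → InClass C.Holds m → Neighbour m → IsLineT m ⊎ IsLineZ m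
    from-neighbour m _ (viaE p m≈) = inj₁ (p , m≈)
    from-neighbour m inC (viaZ c n det≉0 m≈) =
      inj₂ (c , ((n , class-lineZ C.Holds C.resp c c≉0 (inClass-resp C.Holds {m} {lineZ c c≉0} m≈ inC)) , det≉0) ,
            ≈L-trans {m} {lineZ c c≉0} {lineZ′ c} m≈ (lineZ-cong c≉0 (normalised-nonzero (normalised-normalise c)) (Setoid.sym Pairs (normalise-normalised n))))
      where c≉0 = normalised-nonzero n
    from : ∀ {m} → InClass C.Holds m × MeetInOnePoint m ℓ₀ → IsLineT m ⊎ IsLineZ m
    from {m} (inC , meet) = from-neighbour m inC (neighbour m (proj₁ inC) meet)

module Reduction (F : FiniteField) (ω : FiniteField.Carrier F) (¬□ω : ¬ PG3.IsSquare F ω)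
                 (C C′ : SquareInvariant F) (C∩C′≡∅ : ∀ {x} → SquareInvariant.Holds C x → ¬ SquareInvariant.Holds C′ x)
                 (hasCard-C : Counting.HasCard (NormForm.Pairs F ω ¬□ω)
                                (λ c → NormForm.Normalised F ω ¬□ω c × SquareInvariant.Holds C (NormForm.norm F ω ¬□ω c))
                                (NormForm.#half F ω ¬□ω))
                 (hasCard-C′ : Counting.HasCard (NormForm.Pairs F ω ¬□ω)
                                (λ c → NormForm.Normalised F ω ¬□ω c × SquareInvariant.Holds C′ (NormForm.norm F ω ¬□ω c))
                                (NormForm.#half F ω ¬□ω)) where
  open FieldFacts F
  open Space F ω
  open Isometries F ω
  open NormForm F ω ¬□ω
  open ThroughZ F ω ¬□ω
  open SetoidReasoning setoid
  module C = SquareInvariant C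
  module C′ = SquareInvariant C′

  Goal : Line → Set
  Goal ℓ = HasSize (λ m → InClass C.Holds m × MeetInOnePoint m ℓ) (order ℕ.* order ℕ.+ (#half ℕ.∸ 1)) ×
           HasSize (λ m → InClass C′.Holds m × MeetInOnePoint m ℓ) #half

  goal-cong : ∀ {ℓ ℓ′} → ℓ ≈L ℓ′ → Goal ℓ → Goal ℓ′
  goal-cong {ℓ} {ℓ′} ℓ≈ℓ′ (same , other) = transport same , transport other
    where
    transport : ∀ {D : Line → Set} {n} → HasSize (λ m → D m × MeetInOnePoint m ℓ) n → HasSize (λ m → D m × MeetInOnePoint m ℓ′) n
    transport = Counting.hasCard-cong Lines
      (λ {m} (d , meet) → d , meet-resp {m} {m} {ℓ} {ℓ′} (≈L-refl {m}) ℓ≈ℓ′ meet)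
      (λ {m} (d , meet) → d , meet-resp {m} {m} {ℓ′} {ℓ} (≈L-refl {m}) (≈L-sym {ℓ} {ℓ′} ℓ≈ℓ′) meet)

  goal-image⁻¹ : ∀ I ℓ → Goal (image I ℓ) → Goal ℓ
  goal-image⁻¹ I ℓ (same , other) = hasSize-image⁻¹ C.Holds C.resp I ℓ _ same , hasSize-image⁻¹ C′.Holds C′.resp I ℓ _ other

  goal-through-Z : ∀ ℓ → InClass C.Holds ℓ → OnLine Z ℓ → Goal ℓ
  goal-through-Z ℓ inC Z∈ℓ = goal-cong {lineZ A A≉0} {ℓ} (≈L-sym {ℓ} {lineZ A A≉0} ℓ≈) (hasSize-sameClass , hasSize-otherClass)
    where
    through = tangent-through-Z ℓ (proj₁ inC) Z∈ℓ
    A = proj₁ through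
    A≉0 = proj₁ (proj₂ through)
    ℓ≈ = proj₂ (proj₂ through)
    C-A = class-lineZ C.Holds C.resp A A≉0 (inClass-resp C.Holds {ℓ} {lineZ A A≉0} ℓ≈ inC)
    open NeighbourCount F ω ¬□ω A A≉0 C C′ C∩C′≡∅ C-A hasCard-C hasCard-C′ using (hasSize-sameClass; hasSize-otherClass)

  shear-to-Z : ∀ x → OnE x → x X₄ ≈ 1# → shear (- x X₁) (- x X₂) x ≈ᵥ Z
  shear-to-Z x x∈E x₄≈1 0F = trans (+-congˡ (*-congʳ x₄≈1)) (solve 1 (λ a → a ⊕ 𝟙 ⊗ (⊝ a) := 𝟘) refl (x X₁))
  shear-to-Z x x∈E x₄≈1 (sucF 0F) = trans (+-congˡ (*-congʳ x₄≈1)) (solve 1 (λ a → a ⊕ 𝟙 ⊗ (⊝ a) := 𝟘) refl (x X₂))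
  shear-to-Z x x∈E x₄≈1 (sucF (sucF 0F)) = begin
    _ ≈⟨ +-congˡ (-‿cong (+-congˡ (*-congʳ x₄≈1))) ⟩
    _ ≈⟨ solve 4 (λ a b c w → c ⊕ (⊝ ((((a ⊗ (⊝ a)) ⊕ (a ⊗ (⊝ a))) ⊕ (⊝ ((w ⊗ (b ⊗ (⊝ b))) ⊕ (w ⊗ (b ⊗ (⊝ b))))))
                                     ⊕ 𝟙 ⊗ ((⊝ a) ⊗ (⊝ a) ⊕ (⊝ (w ⊗ ((⊝ b) ⊗ (⊝ b)))))))
               := (a ⊗ a ⊕ (⊝ (w ⊗ (b ⊗ b)))) ⊕ c ⊗ 𝟙) refl (x X₁) (x X₂) (x X₃) ω ⟩
    (x X₁ * x X₁ - ω * (x X₂ * x X₂)) + x X₃ * 1# ≈⟨ +-congˡ (*-congˡ (sym x₄≈1)) ⟩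
    Q x ≈⟨ x∈E ⟩
    0# ∎
  shear-to-Z x x∈E x₄≈1 (sucF (sucF (sucF 0F))) = x₄≈1

  goal-X₄≉0 : ∀ ℓ → InClass C.Holds ℓ → ∀ {P} → OnLine P ℓ → OnE P → ¬ P X₄ ≈ 0# → Goal ℓ
  goal-X₄≉0 ℓ inC {P} P∈ℓ P∈E P₄≉0 = goal-image⁻¹ I ℓ
    (goal-through-Z (image I ℓ) (inClass-image I C.Holds C.resp ℓ inC)
      (OnLine-resp (image I ℓ) (shear-to-Z x x∈E x₄≈1) (OnLine-image I ℓ (OnLine-scale ℓ P₄⁻¹ P∈ℓ))))
    where
    P₄⁻¹ = inv (P X₄) P₄≉0
    x = scale P₄⁻¹ P
    x₄≈1 : x X₄ ≈ 1#
    x₄≈1 = *-inverseˡ (P X₄) P₄≉0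
    x∈E : OnE x
    x∈E = begin
      Q x ≈⟨ solve 6 (λ i a b c d w → ((i ⊗ a) ⊗ (i ⊗ a) ⊕ (⊝ (w ⊗ ((i ⊗ b) ⊗ (i ⊗ b))))) ⊕ (i ⊗ c) ⊗ (i ⊗ d)
               := (i ⊗ i) ⊗ ((a ⊗ a ⊕ (⊝ (w ⊗ (b ⊗ b)))) ⊕ c ⊗ d)) refl P₄⁻¹ (P X₁) (P X₂) (P X₃) (P X₄) ω ⟩
      (P₄⁻¹ * P₄⁻¹) * Q P ≈⟨ trans (*-congˡ P∈E) (zeroʳ _) ⟩
      0# ∎
    I = shearing (- x X₁) (- x X₂)

  -- Move the tangent point to Z: first make X₄ ≠ 0 (swapping X₃ and X₄ if needed), then shear.
  goal : ∀ ℓ → InClass C.Holds ℓ → Goal ℓ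
  goal ℓ inC@((P , P≉0 , P∈ℓ , P∈E , _) , _) = by-cases (P X₄ ≟ 0#)
    where
    by-cases : Dec (P X₄ ≈ 0#) → Goal ℓ
    by-cases (no P₄≉0) = goal-X₄≉0 ℓ inC P∈ℓ P∈E P₄≉0
    by-cases (yes P₄≈0) = goal-image⁻¹ swap₃₄ ℓ (goal-X₄≉0 (image swap₃₄ ℓ) (inClass-image swap₃₄ C.Holds C.resp ℓ inC)
      (OnLine-image swap₃₄ ℓ P∈ℓ) (trans (Isometry.Q-to swap₃₄ P) P∈E) P₃≉0)
      where
      P₃≉0 : ¬ P X₃ ≈ 0#
      P₃≉0 P₃≈0 = P≉0 λ i → trans (E∩[X₃≈0]≈Z {P} P∈E P₃≈0 i) (trans (*-congʳ P₄≈0) (zeroˡ _))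

half-suc : ∀ q s → s ℕ.+ s ≡ suc q → (q ℕ.+ 1) ℕ./ 2 ≡ s
half-suc q s s+s≡1+q = ≡.trans (≡.cong (ℕ._/ 2) q+1≡s*2) (DivMod.m*n/n≡m s 2)
  where
  q+1≡s*2 : q ℕ.+ 1 ≡ s ℕ.* 2
  q+1≡s*2 = ≡.trans (ℕP.+-comm q 1) (≡.trans (≡.sym s+s≡1+q) (≡.trans (≡.cong (s ℕ.+_) (≡.sym (ℕP.+-identityʳ s))) (ℕP.*-comm 2 s)))

half-pred : ∀ q s → s ℕ.+ s ≡ suc q → (q ℕ.∸ 1) ℕ./ 2 ≡ s ℕ.∸ 1
half-pred q (suc t) s+s≡1+q = ≡.trans (≡.cong (ℕ._/ 2) q-1≡t*2) (DivMod.m*n/n≡m t 2)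
  where
  q-1≡t*2 : q ℕ.∸ 1 ≡ t ℕ.* 2
  q-1≡t*2 = ≡.trans (≡.cong (ℕ._∸ 1) (≡.sym (ℕP.suc-injective (≡.trans (≡.cong suc (≡.sym (ℕP.+-suc t t))) s+s≡1+q))))
    (≡.trans (≡.cong (t ℕ.+_) (≡.sym (ℕP.+-identityʳ t))) (ℕP.*-comm 2 t))

squares∩nonSquares≡∅ : ∀ F {x} → SquareInvariant.Holds (squares F) x → ¬ SquareInvariant.Holds (nonSquares F) x
squares∩nonSquares≡∅ F □x ¬□x = ¬□x □x

nonSquares∩squares≡∅ : ∀ F {x} → SquareInvariant.Holds (nonSquares F) x → ¬ SquareInvariant.Holds (squares F) x
nonSquares∩squares≡∅ F ¬□x □x = ¬□x □x

open import Data.Nat using (_+_; _^_; _∸_; _/_)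

lemma2p2 : (F : FiniteField) →
    (ω : FiniteField.Carrier F) → ¬ PG3.IsSquare F ω →
    let open PG3 F in let open Quadric ω in
    (ℓ : Line) →
      (InL0 ℓ →
        HasSize (λ m → InL0 m × MeetInOnePoint m ℓ) (FiniteField.order F ^ 2 + (FiniteField.order F ∸ 1) / 2)
        × HasSize (λ m → InL1 m × MeetInOnePoint m ℓ) ((FiniteField.order F + 1) / 2))
      × (InL1 ℓ →
        HasSize (λ m → InL1 m × MeetInOnePoint m ℓ) (FiniteField.order F ^ 2 + (FiniteField.order F ∸ 1) / 2)
        × HasSize (λ m → InL0 m × MeetInOnePoint m ℓ) ((FiniteField.order F + 1) / 2))
lemma2p2 F ω ¬□ω ℓ = (λ inL0 → sizes (SquareLines.goal ℓ inL0)) , (λ inL1 → sizes (NonSquareLines.goal ℓ inL1))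
  where
  open NormForm F ω ¬□ω using (#half; #half+#half≡1+order; hasCard-squareNorm; hasCard-nonSquareNorm)
  open PG3 F using (HasSize)
  module SquareLines = Reduction F ω ¬□ω (squares F) (nonSquares F) (squares∩nonSquares≡∅ F) hasCard-squareNorm hasCard-nonSquareNorm
  module NonSquareLines = Reduction F ω ¬□ω (nonSquares F) (squares F) (nonSquares∩squares≡∅ F) hasCard-nonSquareNorm hasCard-squareNorm
  q = FiniteField.order F
  sizes : ∀ {P P′} → HasSize P (q ℕ.* q ℕ.+ (#half ℕ.∸ 1)) × HasSize P′ #half →
    HasSize P (q ^ 2 + (q ∸ 1) / 2) × HasSize P′ ((q + 1) / 2)
  sizes {P} {P′} (same , other) =
    ≡.subst (HasSize P) (≡.cong₂ _+_ (≡.cong (q ℕ.*_) (≡.sym (ℕP.*-identityʳ q))) (≡.sym (half-pred q #half #half+#half≡1+order))) same ,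
    ≡.subst (HasSize P′) (≡.sym (half-suc q #half #half+#half≡1+order)) other
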